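{- Let $p_j\geq 5$ be the $j$-th prime (with $p_1=2$), $L(p_j)=\prod_{5\leq p\leq p_j}p$, and for primes $p\geq 5$ put $q(p)=\frac1p\prod_{5\le p'<p}\frac{p'-2}{p'}$ (products over primes). (i) For each prime $5\leq p_i\le p_j$, the number of elements of $\mathcal A_{p_i}$ per period $L(p_j)$ (that is, $L(p_j)$ times the natural density of $\mathcal A_{p_i}$) equals $q(p_i)L(p_j)$, and $q(p_i)$ decreases monotonically as $p_i$ increases. (ii) The number of elements of the supergroup $\mathcal S_{p_j}$ per period $L(p_j)$ (that is, $L(p_j)$ times its natural density) is $$S(p_j)=L(p_j)\sum_{5\leq p\leq p_j}q(p)=\frac12L(p_j)\Big(1-\prod_{5\leq p\leq p_j}\frac{p-2}{p}\Big).$$ (iii) The fraction $Q(p_j)=S(p_j)/L(p_j)=\sum_{5\le p\le p_j}q(p)=\frac12\big[1-\prod_{5\leq p\leq p_j}\frac{p-2}{p}\big]$ increases monotonically as $p_j$ increases.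
   Context: For real $x$, $N(x)$ is the integer nearest to $x$. For a prime $q\geq 5$, the non-ranks of $q$ are the integers $(2n+1)q+4N(q/6)$ with $n\geq 0$ and $(2n+1)q-4N(q/6)$ with $n\geq 1$. The parent prime of such an integer is the smallest prime $q\geq 5$ of which it is a non-rank; $\mathcal A_p$ denotes the set of integers with parent prime $p$. The supergroup $\mathcal S_{p_j}=\bigcup_{5\leq p\leq p_j}\mathcal A_p$ is the set of integers that are non-ranks of some prime $p$ with $5\le p\le p_j$. -}

module Defs where

open import Data.Bool using (Bool; true; false; _∧_; _∨_; not)
open import Data.Nat as ℕ using (ℕ; zero; suc; _+_; _*_; _∸_; _≤ᵇ_; _≡ᵇ_; _≤_; _<_; NonZero)
open import Data.Nat.DivMod using (_/_)
open import Data.Nat.Primality using (Prime; prime?)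
open import Data.Integer using (+_)
open import Data.List using (List; upTo)
open import Data.Bool.ListAction using (any; all)
open import Data.Product using (∃; _×_)
open import Relation.Nullary.Decidable using (isYes)
open import Data.Rational as ℚ using (ℚ; 0ℚ; 1ℚ)

isPrimeB : ℕ → Bool
isPrimeB n = isYes (prime? n)

isPrime5B : ℕ → Bool
isPrime5B n = isPrimeB n ∧ (5 ≤ᵇ n)

-- N(a/b): the integer nearest to a/b (rounding halves up), i.e. ⌊(2a+b)/(2b)⌋.
-- (Ties never occur for a/b = q/6 with q a prime ≥ 5.)
nearest : (a b : ℕ) → .{{NonZero b}} → ℕ
nearest a (suc b) = (2 * a + suc b) / (2 * suc b)

shift : ℕ → ℕ
shift q = 4 * nearest q 6

-- m is a non-rank of q:
--   m = (2n+1)q + 4N(q/6) for some n ≥ 0, or m = (2n+1)q − 4N(q/6) for some n ≥ 1.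
-- The witness n is searched in 0..m (resp. 0..m+4N(q/6)); for q ≥ 1 this loses nothing,
-- since m = (2n+1)q + 4N(q/6) forces n ≤ m and m + 4N(q/6) = (2n+1)q forces n ≤ m + 4N(q/6).
isNonRankB : ℕ → ℕ → Bool
isNonRankB q m =
  any (λ n → m ≡ᵇ (2 * n + 1) * q + shift q) (upTo (suc m))
  ∨ any (λ n → (1 ≤ᵇ n) ∧ (m + shift q ≡ᵇ (2 * n + 1) * q)) (upTo (suc m + shift q))

-- m ∈ 𝒜_p : p is the smallest prime ≥ 5 of which m is a non-rank
inAB : ℕ → ℕ → Bool
inAB p m = isPrime5B p ∧ isNonRankB p m
           ∧ all (λ q → not (isPrime5B q ∧ isNonRankB q m)) (upTo p)

inSB : ℕ → ℕ → Bool
inSB pj m = any (λ p → isPrime5B p ∧ inAB p m) (upTo (suc pj))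

count : (ℕ → Bool) → ℕ → ℕ
count f zero = 0
count f (suc N) with f (suc N)
... | true  = suc (count f N)
... | false = count f N

HasDensity : (ℕ → Bool) → ℚ → Set
HasDensity f d =
  ∀ (ε : ℚ) → 0ℚ ℚ.< ε → ∃ λ N₀ → ∀ N → N₀ ≤ N →
    (d ℚ.- ε ℚ.< (+ count f (suc N)) ℚ./ suc N) × ((+ count f (suc N)) ℚ./ suc N ℚ.< d ℚ.+ ε)

prodUpTo : ℕ → ℚ
prodUpTo zero = 1ℚ
prodUpTo (suc n) with isPrime5B (suc n)
... | true  = prodUpTo n ℚ.* ((+ (suc n ∸ 2)) ℚ./ suc n)
... | false = prodUpTo n

qq : (p : ℕ) → .{{NonZero p}} → ℚ
qq p = ((+ 1) ℚ./ p) ℚ.* prodUpTo (p ∸ 1)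

Qsum : ℕ → ℚ
Qsum zero = 0ℚ
Qsum (suc n) with isPrime5B (suc n)
... | true  = Qsum n ℚ.+ qq (suc n)
... | false = Qsum n

-- For m > 4q, m is a non-rank of a prime q ≥ 5 exactly when m is odd and m ≡ ±4N(q/6) (mod q),
-- and these are two distinct nonzero residues modulo q. So, beyond 4p_j, membership in 𝒜_p and
-- in 𝒮_{p_j} is a periodic condition: oddness, plus a sieve by the primes 5 ≤ q ≤ p_j in which
-- each q excludes two residues. By the Chinese remainder theorem the residues modulo ∏ q that
-- survive the sieve number ∏ (q − 2), which yields the counts per period q(p) L and
-- ½ (1 − ∏ (q − 2)/q) L; an eventually periodic set has density (count per period)/period.
-- Both monotonicity claims reduce to ∏ (q − 2)/q strictly decreasing at each new prime.

module Submission where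

open import Data.Bool using (Bool; true; false; _∧_; _∨_; not; if_then_else_)
open import Data.Bool.ListAction using (any; all)
import Data.Bool.Properties as Boolₚ
open import Data.Empty using (⊥; ⊥-elim)
open import Data.Integer as ℤ using (+_; +[1+_]; -[1+_]; +<+)
import Data.Integer.Properties as ℤₚ
import Data.Integer.Tactic.RingSolver as ℤ-Solver
open import Data.List using ([]; _∷_; _∷ʳ_; upTo)
open import Data.List.Properties using (applyUpTo-∷ʳ)
open import Data.Nat
open import Data.Nat.Properties
open import Data.Nat.DivMod
open import Data.Nat.Divisibility using (_∣_; divides; ∣⇒≤; ∣1⇒≡1; m%n≡0⇒n∣m)
open import Data.Nat.Coprimality using (Coprime; coprime-Bézout) renaming (sym to Coprime-sym)
open import Data.Nat.GCD using (module Bézout)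
open import Data.Nat.Primality using (Prime; prime?; prime[2]; euclidsLemma; prime⇒irreducible; prime⇒nonTrivial)
open import Data.Nat.Tactic.RingSolver using (solve-∀; solve)
open import Data.Product using (∃; _×_; _,_; proj₁; proj₂)
open import Data.Rational as ℚ using (mkℚ; 1ℚ; ½)
import Data.Rational.Properties as ℚₚ
open import Data.Rational.Solver using (module +-*-Solver)
open import Data.Rational.Unnormalised as ℚᵘ using (mkℚᵘ; *<*; *≡*)
import Data.Rational.Unnormalised.Properties as ℚᵘₚ
open import Data.Sum using (_⊎_; inj₁; inj₂)
open import Relation.Binary.PropositionalEquality
open import Relation.Nullary using (¬_; yes; no)

open import Defs

bool-ext : ∀ {a b : Bool} → (a ≡ true → b ≡ true) → (b ≡ true → a ≡ true) → a ≡ b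
bool-ext {true}  {true}  _ _ = refl
bool-ext {true}  {false} f _ = sym (f refl)
bool-ext {false} {true}  _ g = g refl
bool-ext {false} {false} _ _ = refl

bool-cases : ∀ b → b ≡ true ⊎ b ≡ false
bool-cases true  = inj₁ refl
bool-cases false = inj₂ refl

∨-elim : ∀ {a b} → a ∨ b ≡ true → a ≡ true ⊎ b ≡ true
∨-elim {true}  _ = inj₁ refl
∨-elim {false} e = inj₂ e

∧-elim : ∀ {a b} → a ∧ b ≡ true → a ≡ true × b ≡ true
∧-elim {true} {true} _ = refl , refl

∨-introˡ : ∀ {a} b → a ≡ true → a ∨ b ≡ true
∨-introˡ _ refl = refl

∨-introʳ : ∀ a {b} → b ≡ true → a ∨ b ≡ true
∨-introʳ true  _ = refl
∨-introʳ false e = e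

∧-intro : ∀ {a b} → a ≡ true → b ≡ true → a ∧ b ≡ true
∧-intro refl refl = refl

≡ᵇ-true⇒≡ : ∀ {m n} → (m ≡ᵇ n) ≡ true → m ≡ n
≡ᵇ-true⇒≡ {m} {n} e = ≡ᵇ⇒≡ m n (subst Data.Bool.T (sym e) _)

≡⇒≡ᵇ-true : ∀ {m n} → m ≡ n → (m ≡ᵇ n) ≡ true
≡⇒≡ᵇ-true {m} {n} e with m ≡ᵇ n | ≡⇒≡ᵇ m n e
... | true | _ = refl

≤ᵇ-true⇒≤ : ∀ {m n} → (m ≤ᵇ n) ≡ true → m ≤ n
≤ᵇ-true⇒≤ {m} {n} e = ≤ᵇ⇒≤ m n (subst Data.Bool.T (sym e) _)

≤⇒≤ᵇ-true : ∀ {m n} → m ≤ n → (m ≤ᵇ n) ≡ true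
≤⇒≤ᵇ-true {m} {n} e with m ≤ᵇ n | ≤⇒≤ᵇ e
... | true | _ = refl

any-upTo-suc : ∀ (F : ℕ → Bool) n → any F (upTo (suc n)) ≡ any F (upTo n) ∨ F n
any-upTo-suc F n = trans (cong (any F) (sym (applyUpTo-∷ʳ (λ x → x) n))) (any-∷ʳ (upTo n))
  where
  any-∷ʳ : ∀ xs → any F (xs ∷ʳ n) ≡ any F xs ∨ F n
  any-∷ʳ []       = Boolₚ.∨-identityʳ (F n)
  any-∷ʳ (y ∷ xs) = trans (cong (F y ∨_) (any-∷ʳ xs)) (sym (Boolₚ.∨-assoc (F y) _ _))

all-upTo-suc : ∀ (F : ℕ → Bool) n → all F (upTo (suc n)) ≡ all F (upTo n) ∧ F n
all-upTo-suc F n = trans (cong (all F) (sym (applyUpTo-∷ʳ (λ x → x) n))) (all-∷ʳ (upTo n))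
  where
  all-∷ʳ : ∀ xs → all F (xs ∷ʳ n) ≡ all F xs ∧ F n
  all-∷ʳ []       = Boolₚ.∧-identityʳ (F n)
  all-∷ʳ (y ∷ xs) = trans (cong (F y ∧_) (all-∷ʳ xs)) (sym (Boolₚ.∧-assoc (F y) _ _))

any-upTo-intro : ∀ F n k → k < n → F k ≡ true → any F (upTo n) ≡ true
any-upTo-intro F (suc n) k k<1+n e with m≤n⇒m<n∨m≡n (s≤s⁻¹ k<1+n)
... | inj₁ k<n  = trans (any-upTo-suc F n) (∨-introˡ (F n) (any-upTo-intro F n k k<n e))
... | inj₂ refl = trans (any-upTo-suc F n) (∨-introʳ (any F (upTo n)) e)

any-upTo-elim : ∀ F n → any F (upTo n) ≡ true → ∃ λ k → k < n × F k ≡ true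
any-upTo-elim F (suc n) e with ∨-elim {any F (upTo n)} (trans (sym (any-upTo-suc F n)) e)
... | inj₁ e′ = let (k , k<n , Fk) = any-upTo-elim F n e′ in k , m<n⇒m<1+n k<n , Fk
... | inj₂ e′ = n , ≤-refl , e′

all-upTo-cong : ∀ F G n → (∀ k → k < n → F k ≡ G k) → all F (upTo n) ≡ all G (upTo n)
all-upTo-cong F G zero    _ = refl
all-upTo-cong F G (suc n) h = begin
  all F (upTo (suc n))      ≡⟨ all-upTo-suc F n ⟩
  all F (upTo n) ∧ F n      ≡⟨ cong₂ _∧_ (all-upTo-cong F G n (λ k k<n → h k (m<n⇒m<1+n k<n))) (h n ≤-refl) ⟩
  all G (upTo n) ∧ G n      ≡⟨ all-upTo-suc G n ⟨
  all G (upTo (suc n))      ∎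
  where open ≡-Reasoning

-- Counting in intervals and periodicity

m+n+o≡m+o+n : ∀ m n o → m + n + o ≡ m + o + n
m+n+o≡m+o+n = solve-∀

[m+n]+[o+p]≡[m+o]+[n+p] : ∀ m n o p → (m + n) + (o + p) ≡ (m + o) + (n + p)
[m+n]+[o+p]≡[m+o]+[n+p] = solve-∀

m*n*o≡m*o*n : ∀ m n o → m * n * o ≡ m * o * n
m*n*o≡m*o*n = solve-∀

m*[n*o]≡n*[m*o] : ∀ m n o → m * (n * o) ≡ n * (m * o)
m*[n*o]≡n*[m*o] = solve-∀

indicator : Bool → ℕ
indicator true  = 1
indicator false = 0

indicator-∧ : ∀ a b → indicator (a ∧ b) ≡ indicator a * indicator b
indicator-∧ true  b = sym (+-identityʳ _)
indicator-∧ false b = refl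

indicator-not : ∀ b → indicator (not b) + indicator b ≡ 1
indicator-not true  = refl
indicator-not false = refl

indicator-≤1 : ∀ b → indicator b ≤ 1
indicator-≤1 true  = ≤-refl
indicator-≤1 false = z≤n

sumFrom : (ℕ → ℕ) → ℕ → ℕ → ℕ
sumFrom f a zero    = 0
sumFrom f a (suc n) = f a + sumFrom f (suc a) n

countFrom : (ℕ → Bool) → ℕ → ℕ → ℕ
countFrom g = sumFrom (λ x → indicator (g x))

sumFrom-++ : ∀ f a n k → sumFrom f a (n + k) ≡ sumFrom f a n + sumFrom f (a + n) k
sumFrom-++ f a zero    k = cong (λ z → sumFrom f z k) (sym (+-identityʳ a))
sumFrom-++ f a (suc n) k rewrite sumFrom-++ f (suc a) n k | +-suc a n = sym (+-assoc (f a) _ _)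

sumFrom-cong : ∀ f g a n → (∀ i → i < n → f (a + i) ≡ g (a + i)) → sumFrom f a n ≡ sumFrom g a n
sumFrom-cong f g a zero    _ = refl
sumFrom-cong f g a (suc n) h = cong₂ _+_
  (subst (λ z → f z ≡ g z) (+-identityʳ a) (h 0 z<s))
  (sumFrom-cong f g (suc a) n λ i i<n → subst (λ z → f z ≡ g z) (+-suc a i) (h (suc i) (s<s i<n)))

sumFrom-+ : ∀ f g a n → sumFrom (λ x → f x + g x) a n ≡ sumFrom f a n + sumFrom g a n
sumFrom-+ f g a zero    = refl
sumFrom-+ f g a (suc n) rewrite sumFrom-+ f g (suc a) n =
  [m+n]+[o+p]≡[m+o]+[n+p] (f a) (g a) (sumFrom f (suc a) n) (sumFrom g (suc a) n)

sumFrom-const : ∀ c a n → sumFrom (λ _ → c) a n ≡ n * c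
sumFrom-const c a zero    = refl
sumFrom-const c a (suc n) = cong (_+_ c) (sumFrom-const c (suc a) n)

sumFrom-*ʳ : ∀ f k a n → sumFrom (λ x → f x * k) a n ≡ sumFrom f a n * k
sumFrom-*ʳ f k a zero    = refl
sumFrom-*ʳ f k a (suc n) rewrite sumFrom-*ʳ f k (suc a) n = sym (*-distribʳ-+ k (f a) _)

sumFrom-shift : ∀ f T a n → sumFrom (λ x → f (x + T)) a n ≡ sumFrom f (a + T) n
sumFrom-shift f T a zero    = refl
sumFrom-shift f T a (suc n) = cong (_+_ (f (a + T))) (sumFrom-shift f T (suc a) n)

countFrom-≤ : ∀ g a n → countFrom g a n ≤ n
countFrom-≤ g a zero    = z≤n
countFrom-≤ g a (suc n) = +-mono-≤ (indicator-≤1 (g a)) (countFrom-≤ g (suc a) n)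

countFrom-not : ∀ g a n → countFrom (λ m → not (g m)) a n ≡ n ∸ countFrom g a n
countFrom-not g a n = trans (sym (m+n∸n≡m _ (countFrom g a n))) (cong (_∸ countFrom g a n) (complement a n))
  where
  open ≡-Reasoning
  complement : ∀ a n → countFrom (λ m → not (g m)) a n + countFrom g a n ≡ n
  complement a zero    = refl
  complement a (suc n) = begin
    indicator (not (g a)) + countFrom (λ m → not (g m)) (suc a) n + (indicator (g a) + countFrom g (suc a) n)
      ≡⟨ [m+n]+[o+p]≡[m+o]+[n+p] (indicator (not (g a))) _ (indicator (g a)) _ ⟩
    indicator (not (g a)) + indicator (g a) + (countFrom (λ m → not (g m)) (suc a) n + countFrom g (suc a) n)
      ≡⟨ cong₂ _+_ (indicator-not (g a)) (complement (suc a) n) ⟩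
    suc n ∎

Periodic : {A : Set} → (ℕ → A) → ℕ → Set
Periodic g T = ∀ m → g (m + T) ≡ g m

periodic-* : ∀ {A : Set} (g : ℕ → A) {T} → Periodic g T → ∀ m k → g (m + k * T) ≡ g m
periodic-* g {T} per m zero    = cong g (+-identityʳ m)
periodic-* g {T} per m (suc k) = begin
  g (m + (T + k * T))  ≡⟨ cong g (trans (sym (+-assoc m T (k * T))) (m+n+o≡m+o+n m T (k * T))) ⟩
  g (m + k * T + T)    ≡⟨ per (m + k * T) ⟩
  g (m + k * T)        ≡⟨ periodic-* g per m k ⟩
  g m                  ∎
  where open ≡-Reasoning

periodic-not : ∀ g {T} → Periodic g T → Periodic (λ m → not (g m)) T
periodic-not g per m = cong not (per m)

countFrom-period-start : ∀ g {T} → Periodic g T → ∀ a → countFrom g a T ≡ countFrom g 0 T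
countFrom-period-start g     per zero    = refl
countFrom-period-start g {T} per (suc a) =
  trans (+-cancelˡ-≡ (indicator (g a)) _ _ slide) (countFrom-period-start g per a)
  where
  open ≡-Reasoning
  slide : indicator (g a) + countFrom g (suc a) T ≡ indicator (g a) + countFrom g a T
  slide = begin
    indicator (g a) + countFrom g (suc a) T          ≡⟨ cong (countFrom g a) (+-comm 1 T) ⟩
    countFrom g a (T + 1)                            ≡⟨ sumFrom-++ (λ x → indicator (g x)) a T 1 ⟩
    countFrom g a T + (indicator (g (a + T)) + 0)    ≡⟨ cong (λ b → countFrom g a T + (indicator b + 0)) (per a) ⟩
    countFrom g a T + (indicator (g a) + 0)          ≡⟨ cong (_+_ (countFrom g a T)) (+-identityʳ _) ⟩
    countFrom g a T + indicator (g a)                ≡⟨ +-comm (countFrom g a T) _ ⟩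
    indicator (g a) + countFrom g a T                ∎

countFrom-periods : ∀ g {T} → Periodic g T → ∀ a k → countFrom g a (k * T) ≡ k * countFrom g 0 T
countFrom-periods g     per a zero    = refl
countFrom-periods g {T} per a (suc k) = trans (sumFrom-++ (λ x → indicator (g x)) a T (k * T))
  (cong₂ _+_ (countFrom-period-start g per a) (countFrom-periods g per (a + T) k))

strideSum : (ℕ → ℕ) → ℕ → ℕ → ℕ → ℕ
strideSum f x T zero    = 0
strideSum f x T (suc k) = f x + strideSum f (x + T) T k

sumFrom-by-residues : ∀ f T r a → sumFrom f a (r * T) ≡ sumFrom (λ x → strideSum f x T r) a T
sumFrom-by-residues f T zero    a = sym (trans (sumFrom-const 0 a T) (*-zeroʳ T))
sumFrom-by-residues f T (suc r) a = begin
  sumFrom f a (T + r * T)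
    ≡⟨ sumFrom-++ f a T (r * T) ⟩
  sumFrom f a T + sumFrom f (a + T) (r * T)
    ≡⟨ cong (_+_ (sumFrom f a T)) (sumFrom-by-residues f T r (a + T)) ⟩
  sumFrom f a T + sumFrom (λ x → strideSum f x T r) (a + T) T
    ≡⟨ cong (_+_ (sumFrom f a T)) (sumFrom-shift (λ x → strideSum f x T r) T a T) ⟨
  sumFrom f a T + sumFrom (λ x → strideSum f (x + T) T r) a T
    ≡⟨ sumFrom-+ f (λ x → strideSum f (x + T) T r) a T ⟨
  sumFrom (λ x → strideSum f x T (suc r)) a T ∎
  where open ≡-Reasoning

strideSum-∧ : ∀ (g h : ℕ → Bool) {T} → Periodic g T → ∀ k x →
  strideSum (λ y → indicator (g y ∧ h y)) x T k ≡ indicator (g x) * strideSum (λ y → indicator (h y)) x T k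
strideSum-∧ g h     per zero    x = sym (*-zeroʳ (indicator (g x)))
strideSum-∧ g h {T} per (suc k) x rewrite strideSum-∧ g h per k (x + T) | per x | indicator-∧ (g x) (h x) =
  sym (*-distribˡ-+ (indicator (g x)) (indicator (h x)) _)

strideSum-last : ∀ f x T k → strideSum f x T (suc k) ≡ strideSum f x T k + f (x + k * T)
strideSum-last f x T zero    rewrite +-identityʳ x = +-comm (f x) 0
strideSum-last f x T (suc k) rewrite strideSum-last f (x + T) T k | +-assoc x T (k * T) =
  sym (+-assoc (f x) _ _)

strideSum-periodic : ∀ f {r} → Periodic f r → ∀ T k x → strideSum f (x + r) T k ≡ strideSum f x T k
strideSum-periodic f     per T zero    x = refl
strideSum-periodic f {r} per T (suc k) x =
  cong₂ _+_ (per x) (trans (cong (λ z → strideSum f z T k) (m+n+o≡m+o+n x r T)) (strideSum-periodic f per T k (x + T)))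

periodic-resp : ∀ {f g : ℕ → Bool} {T} → (∀ m → f m ≡ g m) → Periodic g T → Periodic f T
periodic-resp f≗g g-per m = trans (f≗g _) (trans (g-per m) (sym (f≗g m)))

countFrom-resp : ∀ (f g : ℕ → Bool) a n → (∀ m → f m ≡ g m) → countFrom f a n ≡ countFrom g a n
countFrom-resp f g a n f≗g = sumFrom-cong _ _ a n (λ i _ → cong indicator (f≗g (a + i)))

module CoprimePeriods (g h : ℕ → Bool) (T r : ℕ) .{{_ : NonZero T}}
                      (g-per : Periodic g T) (h-per : Periodic h r) (T⊥r : Coprime T r) where

  hits : ℕ → ℕ
  hits x = strideSum (λ y → indicator (h y)) x T r

  hits-per-T : Periodic hits T
  hits-per-T x = +-cancelˡ-≡ (indicator (h x)) _ _ (begin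
    indicator (h x) + hits (x + T)          ≡⟨ strideSum-last (λ y → indicator (h y)) x T r ⟩
    hits x + indicator (h (x + r * T))      ≡⟨ cong (λ z → hits x + indicator (h (x + z))) (*-comm r T) ⟩
    hits x + indicator (h (x + T * r))      ≡⟨ cong (λ b → hits x + indicator b) (periodic-* h h-per x T) ⟩
    hits x + indicator (h x)                ≡⟨ +-comm (hits x) _ ⟩
    indicator (h x) + hits x                ∎)
    where open ≡-Reasoning

  hits-per-r : Periodic hits r
  hits-per-r x = strideSum-periodic (λ y → indicator (h y)) (λ m → cong indicator (h-per m)) T r x

  -- A function with the coprime periods T and r has period 1, by Bézout.
  hits-per-1 : Periodic hits 1
  hits-per-1 x with coprime-Bézout T⊥r
  ... | Bézout.+- a b eq = begin
    hits (x + 1)          ≡⟨ periodic-* hits hits-per-r (x + 1) b ⟨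
    hits (x + 1 + b * r)  ≡⟨ cong hits (trans (+-assoc x 1 (b * r)) (cong (_+_ x) eq)) ⟩
    hits (x + a * T)      ≡⟨ periodic-* hits hits-per-T x a ⟩
    hits x                ∎
    where open ≡-Reasoning
  ... | Bézout.-+ a b eq = begin
    hits (x + 1)          ≡⟨ periodic-* hits hits-per-T (x + 1) a ⟨
    hits (x + 1 + a * T)  ≡⟨ cong hits (trans (+-assoc x 1 (a * T)) (cong (_+_ x) eq)) ⟩
    hits (x + b * r)      ≡⟨ periodic-* hits hits-per-r x b ⟩
    hits x                ∎
    where open ≡-Reasoning

  hits-constant : ∀ x → hits x ≡ countFrom h 0 r
  hits-constant x = trans (from-0 x) hits-0
    where
    from-0 : ∀ x → hits x ≡ hits 0
    from-0 zero    = refl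
    from-0 (suc x) = trans (cong hits (+-comm 1 x)) (trans (hits-per-1 x) (from-0 x))
    open ≡-Reasoning
    hits-0 : hits 0 ≡ countFrom h 0 r
    hits-0 = *-cancelˡ-≡ (hits 0) (countFrom h 0 r) T (begin
      T * hits 0                                   ≡⟨ sumFrom-const (hits 0) 0 T ⟨
      sumFrom (λ _ → hits 0) 0 T                   ≡⟨ sumFrom-cong _ _ 0 T (λ i _ → sym (from-0 i)) ⟩
      sumFrom hits 0 T                             ≡⟨ sumFrom-by-residues (λ y → indicator (h y)) T r 0 ⟨
      countFrom h 0 (r * T)                        ≡⟨ cong (countFrom h 0) (*-comm r T) ⟩
      countFrom h 0 (T * r)                        ≡⟨ countFrom-periods h h-per 0 T ⟩
      T * countFrom h 0 r                          ∎)

  periodic-∧ : Periodic (λ m → g m ∧ h m) (T * r)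
  periodic-∧ m = cong₂ _∧_
    (trans (cong (λ z → g (m + z)) (*-comm T r)) (periodic-* g g-per m r))
    (periodic-* h h-per m T)

  countFrom-∧ : countFrom (λ m → g m ∧ h m) 0 (T * r) ≡ countFrom g 0 T * countFrom h 0 r
  countFrom-∧ = begin
    countFrom (λ m → g m ∧ h m) 0 (T * r)
      ≡⟨ cong (countFrom (λ m → g m ∧ h m) 0) (*-comm T r) ⟩
    countFrom (λ m → g m ∧ h m) 0 (r * T)
      ≡⟨ sumFrom-by-residues _ T r 0 ⟩
    sumFrom (λ x → strideSum (λ y → indicator (g y ∧ h y)) x T r) 0 T
      ≡⟨ sumFrom-cong _ _ 0 T (λ i _ → strideSum-∧ g h {T} g-per r i) ⟩
    sumFrom (λ x → indicator (g x) * hits x) 0 T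
      ≡⟨ sumFrom-cong _ _ 0 T (λ i _ → cong (indicator (g i) *_) (hits-constant i)) ⟩
    sumFrom (λ x → indicator (g x) * countFrom h 0 r) 0 T
      ≡⟨ sumFrom-*ʳ (λ x → indicator (g x)) (countFrom h 0 r) 0 T ⟩
    countFrom g 0 T * countFrom h 0 r ∎
    where open ≡-Reasoning

isOdd : ℕ → Bool
isOdd m = m % 2 ≡ᵇ 1

isOdd-periodic : Periodic isOdd 2
isOdd-periodic m = cong (_≡ᵇ 1) ([m+n]%n≡m%n m 2)

%2-cases : ∀ m → m % 2 ≡ 0 ⊎ m % 2 ≡ 1
%2-cases m with m % 2 | m%n<n m 2
... | 0 | _ = inj₁ refl
... | 1 | _ = inj₂ refl
... | suc (suc _) | s≤s (s≤s ())

[m+e]%2≡m%2 : ∀ m e → e % 2 ≡ 0 → (m + e) % 2 ≡ m % 2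
[m+e]%2≡m%2 m e e-even = begin
  (m + e) % 2               ≡⟨ %-distribˡ-+ m e 2 ⟩
  (m % 2 + e % 2) % 2       ≡⟨ cong (λ z → (m % 2 + z) % 2) e-even ⟩
  (m % 2 + 0) % 2           ≡⟨ cong (_% 2) (+-identityʳ (m % 2)) ⟩
  m % 2 % 2                 ≡⟨ m%n%n≡m%n m 2 ⟩
  m % 2                     ∎
  where open ≡-Reasoning

[k*q]%2≡k%2 : ∀ k q → q % 2 ≡ 1 → (k * q) % 2 ≡ k % 2
[k*q]%2≡k%2 k q q-odd = begin
  (k * q) % 2               ≡⟨ %-distribˡ-* k q 2 ⟩
  (k % 2 * (q % 2)) % 2     ≡⟨ cong (λ z → (k % 2 * z) % 2) q-odd ⟩
  (k % 2 * 1) % 2           ≡⟨ cong (_% 2) (*-identityʳ (k % 2)) ⟩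
  k % 2 % 2                 ≡⟨ m%n%n≡m%n k 2 ⟩
  k % 2                     ∎
  where open ≡-Reasoning

odd⇒≡2*[k/2]+1 : ∀ k → k % 2 ≡ 1 → k ≡ 2 * (k / 2) + 1
odd⇒≡2*[k/2]+1 k k-odd = begin
  k                         ≡⟨ m≡m%n+[m/n]*n k 2 ⟩
  k % 2 + k / 2 * 2         ≡⟨ cong (_+ k / 2 * 2) k-odd ⟩
  1 + k / 2 * 2             ≡⟨ +-comm 1 (k / 2 * 2) ⟩
  k / 2 * 2 + 1             ≡⟨ cong (_+ 1) (*-comm (k / 2) 2) ⟩
  2 * (k / 2) + 1           ∎
  where open ≡-Reasoning

[2n+1]%2≡1 : ∀ n → (2 * n + 1) % 2 ≡ 1
[2n+1]%2≡1 n = trans (cong (_% 2) (trans (+-comm (2 * n) 1) (cong (_+_ 1) (*-comm 2 n)))) ([m+kn]%n≡m%n 1 n 2)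

prime≢1 : ∀ {r} → Prime r → r ≢ 1
prime≢1 pr = nonTrivial⇒≢1 {{prime⇒nonTrivial pr}}

prime∣prime⇒≡ : ∀ {r q} → Prime r → Prime q → r ∣ q → r ≡ q
prime∣prime⇒≡ pr pq r∣q with prime⇒irreducible pq r∣q
... | inj₁ r≡1 = ⊥-elim (prime≢1 pr r≡1)
... | inj₂ r≡q = r≡q

prime∤⇒coprime : ∀ {r x} → Prime r → ¬ r ∣ x → Coprime r x
prime∤⇒coprime pr r∤x (d∣r , d∣x) with prime⇒irreducible pr d∣r
... | inj₁ d≡1  = d≡1
... | inj₂ refl = ⊥-elim (r∤x d∣x)

isPrime5B-sound : ∀ q → isPrime5B q ≡ true → Prime q × 5 ≤ q
isPrime5B-sound q e with prime? q
... | yes pq = pq , ≤ᵇ-true⇒≤ e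

isPrime5B-complete : ∀ q → Prime q → 5 ≤ q → isPrime5B q ≡ true
isPrime5B-complete q pq 5≤q with prime? q
... | yes _ = ≤⇒≤ᵇ-true 5≤q
... | no ¬pq = ⊥-elim (¬pq pq)

≥5⇒≢2 : ∀ {q} → 5 ≤ q → q ≢ 2
≥5⇒≢2 (s≤s (s≤s ())) refl

prime≥5⇒odd : ∀ q → Prime q → 5 ≤ q → q % 2 ≡ 1
prime≥5⇒odd q pq 5≤q with %2-cases q
... | inj₂ q-odd  = q-odd
... | inj₁ q-even = ⊥-elim (≥5⇒≢2 5≤q (sym (prime∣prime⇒≡ prime[2] pq (m%n≡0⇒n∣m q 2 q-even))))

shift%2≡0 : ∀ q → shift q % 2 ≡ 0
shift%2≡0 q = trans (cong (_% 2) (4x≡2x*2 (nearest q 6))) (m*n%n≡0 (2 * nearest q 6) 2)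
  where
  4x≡2x*2 : ∀ x → 4 * x ≡ 2 * x * 2
  4x≡2x*2 = solve-∀

shift≤4q : ∀ q → shift q ≤ 4 * q
shift≤4q q = *-monoʳ-≤ 4 (s≤s⁻¹ (m<n*o⇒m/o<n {2 * q + 6} {suc q} {12} bound))
  where
  bound : 2 * q + 6 < suc q * 12
  bound = s≤s (≤-trans (≤-reflexive (+-comm (2 * q) 6))
                       (+-mono-≤ (m≤m+n 6 5) (≤-trans (*-monoˡ-≤ q (m≤m+n 2 10)) (≤-reflexive (*-comm 12 q)))))

0<nearest<q : ∀ q → 5 ≤ q → 0 < nearest q 6 × nearest q 6 < q
0<nearest<q q 5≤q = subst (λ z → 0 < nearest z 6 × nearest z 6 < z) (m+[n∸m]≡n 5≤q) (bounds (q ∸ 5))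
  where
  bounds : ∀ t → 0 < nearest (5 + t) 6 × nearest (5 + t) 6 < 5 + t
  bounds t = m≥n⇒m/n>0 {2 * (5 + t) + 6} {12} (≤-trans (m≤m+n 12 (4 + 2 * t)) (≤-reflexive (solve (t ∷ []))))
           , m<n*o⇒m/o<n {2 * (5 + t) + 6} {5 + t} {12} (≤-trans (m≤m+n _ (43 + 10 * t)) (≤-reflexive (solve (t ∷ []))))

-- A prime q ≥ 5 divides neither 4 nor N(q/6), since 0 < N(q/6) < q.
shift%q≢0 : ∀ q .{{_ : NonZero q}} → Prime q → 5 ≤ q → shift q % q ≢ 0
shift%q≢0 q pq 5≤q shift%q≡0 with euclidsLemma 4 (nearest q 6) pq (m%n≡0⇒n∣m (shift q) q shift%q≡0)
... | inj₁ q∣4 = <⇒≱ 5≤q (∣⇒≤ q∣4)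
... | inj₂ q∣N = <⇒≱ (proj₂ (0<nearest<q q 5≤q)) (∣⇒≤ {{>-nonZero (proj₁ (0<nearest<q q 5≤q))}} q∣N)

-- Non-rank residues

-- Together with oddness of m, this characterises the non-ranks m > 4q of q; the value at
-- q = 0 is junk.
nonRankResidue : ℕ → ℕ → Bool
nonRankResidue zero      m = false
nonRankResidue q@(suc _) m = (m % q ≡ᵇ shift q % q) ∨ ((m + shift q) % q ≡ᵇ 0)

nonRankResidue-periodic : ∀ q → Periodic (nonRankResidue q) q
nonRankResidue-periodic zero      m = refl
nonRankResidue-periodic q@(suc _) m = cong₂ _∨_
  (cong (_≡ᵇ shift q % q) ([m+n]%n≡m%n m q))
  (cong (_≡ᵇ 0) (trans (cong (_% q) (m+n+o≡m+o+n m q (shift q))) ([m+n]%n≡m%n (m + shift q) q)))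

countFrom-≡ᵇ-before : ∀ u a n → u < a → countFrom (_≡ᵇ u) a n ≡ 0
countFrom-≡ᵇ-before u a zero    u<a = refl
countFrom-≡ᵇ-before u a (suc n) u<a with a ≡ᵇ u in a≡ᵇu
... | true  = ⊥-elim (<-irrefl (sym (≡ᵇ-true⇒≡ a≡ᵇu)) u<a)
... | false = countFrom-≡ᵇ-before u (suc a) n (m<n⇒m<1+n u<a)

countFrom-≡ᵇ : ∀ u a n → a ≤ u → u < a + n → countFrom (_≡ᵇ u) a n ≡ 1
countFrom-≡ᵇ u a zero    a≤u u<a+0 = ⊥-elim (<⇒≱ u<a+0 (subst (_≤ u) (sym (+-identityʳ a)) a≤u))
countFrom-≡ᵇ u a (suc n) a≤u u<a+n with a ≡ᵇ u in a≡ᵇu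
... | true  = cong suc (countFrom-≡ᵇ-before u (suc a) n (s≤s (≤-reflexive (sym (≡ᵇ-true⇒≡ a≡ᵇu)))))
... | false = countFrom-≡ᵇ u (suc a) n (≤∧≢⇒< a≤u a≢u) (subst (u <_) (+-suc a n) u<a+n)
  where
  a≢u : a ≢ u
  a≢u a≡u with () ← trans (sym a≡ᵇu) (≡⇒≡ᵇ-true a≡u)

countFrom-two-points : ∀ u v q → u < q → v < q → u ≢ v → countFrom (λ m → (m ≡ᵇ u) ∨ (m ≡ᵇ v)) 0 q ≡ 2
countFrom-two-points u v q u<q v<q u≢v = begin
  countFrom (λ m → (m ≡ᵇ u) ∨ (m ≡ᵇ v)) 0 q
    ≡⟨ sumFrom-cong _ _ 0 q (λ i _ → indicator-∨ (i ≡ᵇ u) (i ≡ᵇ v) (λ i≡u i≡v → u≢v (trans (sym (≡ᵇ-true⇒≡ {i} i≡u)) (≡ᵇ-true⇒≡ {i} i≡v)))) ⟩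
  sumFrom (λ m → indicator (m ≡ᵇ u) + indicator (m ≡ᵇ v)) 0 q
    ≡⟨ sumFrom-+ (λ m → indicator (m ≡ᵇ u)) (λ m → indicator (m ≡ᵇ v)) 0 q ⟩
  countFrom (_≡ᵇ u) 0 q + countFrom (_≡ᵇ v) 0 q
    ≡⟨ cong₂ _+_ (countFrom-≡ᵇ u 0 q z≤n u<q) (countFrom-≡ᵇ v 0 q z≤n v<q) ⟩
  2 ∎
  where
  open ≡-Reasoning
  indicator-∨ : ∀ a b → (a ≡ true → b ≡ true → ⊥) → indicator (a ∨ b) ≡ indicator a + indicator b
  indicator-∨ true  true  disjoint = ⊥-elim (disjoint refl refl)
  indicator-∨ true  false _        = refl
  indicator-∨ false b     _        = refl

-- The residues u = 4N(q/6) mod q and q − u are distinct because q is odd.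
module ResidueCount (k : ℕ) (q-odd : suc k % 2 ≡ 1) (u≢0 : shift (suc k) % suc k ≢ 0) where

  q = suc k
  s = shift q
  u = s % q

  u<q : u < q
  u<q = m%n<n s q

  q∸u<q : q ∸ u < q
  q∸u<q = ∸-monoʳ-< {q} {u} {0} (n≢0⇒n>0 u≢0) (<⇒≤ u<q)

  u≢q∸u : u ≢ q ∸ u
  u≢q∸u u≡q∸u = 0≢1+n (trans (sym q-even) q-odd)
    where
    q≡u*2 : q ≡ u * 2
    q≡u*2 = begin
      q             ≡⟨ m∸n+n≡m (<⇒≤ u<q) ⟨
      q ∸ u + u     ≡⟨ cong (_+ u) u≡q∸u ⟨
      u + u         ≡⟨ cong (_+_ u) (+-identityʳ u) ⟨
      2 * u         ≡⟨ *-comm 2 u ⟩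
      u * 2         ∎
      where open ≡-Reasoning
    q-even : q % 2 ≡ 0
    q-even = trans (cong (_% 2) q≡u*2) (m*n%n≡0 u 2)

  [m+s]%q≡0⇔m≡q∸u : ∀ m → m < q → ((m + s) % q ≡ᵇ 0) ≡ (m ≡ᵇ q ∸ u)
  [m+s]%q≡0⇔m≡q∸u m m<q = bool-ext to from
    where
    [m+s]%q≡[m+u]%q : (m + s) % q ≡ (m + u) % q
    [m+s]%q≡[m+u]%q = trans (%-distribˡ-+ m s q) (cong (λ z → (z + u) % q) (m<n⇒m%n≡m m<q))
    -- 0 < m + u < 2q, so q ∣ m + u forces m + u = q.
    to : ((m + s) % q ≡ᵇ 0) ≡ true → (m ≡ᵇ q ∸ u) ≡ true
    to e with m%n≡0⇒n∣m (m + u) q (trans (sym [m+s]%q≡[m+u]%q) (≡ᵇ-true⇒≡ e))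
    ... | divides zero          m+u≡0   = ⊥-elim (u≢0 (m+n≡0⇒n≡0 m m+u≡0))
    ... | divides (suc zero)    m+u≡q   =
      ≡⇒≡ᵇ-true (sym (trans (cong (_∸ u) (trans (sym (+-identityʳ q)) (sym m+u≡q))) (m+n∸n≡m m u)))
    ... | divides (suc (suc j)) m+u≡jq  = ⊥-elim (<⇒≱ (+-mono-< m<q u<q)
          (≤-trans (+-monoʳ-≤ q (m≤m+n q (j * q))) (≤-reflexive (sym m+u≡jq))))
    from : (m ≡ᵇ q ∸ u) ≡ true → ((m + s) % q ≡ᵇ 0) ≡ true
    from e = ≡⇒≡ᵇ-true (begin
      (m + s) % q        ≡⟨ [m+s]%q≡[m+u]%q ⟩
      (m + u) % q        ≡⟨ cong (λ z → (z + u) % q) (≡ᵇ-true⇒≡ {m} {q ∸ u} e) ⟩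
      (q ∸ u + u) % q    ≡⟨ cong (_% q) (m∸n+n≡m (<⇒≤ u<q)) ⟩
      q % q              ≡⟨ n%n≡0 q ⟩
      0                  ∎)
      where open ≡-Reasoning

  nonRankResidue-below-q : ∀ m → m < q → nonRankResidue q m ≡ (m ≡ᵇ u) ∨ (m ≡ᵇ q ∸ u)
  nonRankResidue-below-q m m<q = cong₂ _∨_ (cong (_≡ᵇ u) (m<n⇒m%n≡m m<q)) ([m+s]%q≡0⇔m≡q∸u m m<q)

  countFrom-nonRankResidue : countFrom (nonRankResidue q) 0 q ≡ 2
  countFrom-nonRankResidue =
    trans (sumFrom-cong _ _ 0 q (λ i i<q → cong indicator (nonRankResidue-below-q i i<q)))
          (countFrom-two-points u (q ∸ u) q u<q q∸u<q u≢q∸u)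

countFrom-nonRankResidue : ∀ q → Prime q → 5 ≤ q → countFrom (nonRankResidue q) 0 q ≡ 2
countFrom-nonRankResidue q@(suc k) pq 5≤q =
  ResidueCount.countFrom-nonRankResidue k (prime≥5⇒odd q pq 5≤q) (shift%q≢0 q pq 5≤q)

-- As 4N(q/6) is even, (2n + 1)q ± 4N(q/6) is odd; conversely m ≡ ±4N(q/6) (mod q) with m odd
-- forces an odd cofactor of q.
module NonRanks (k : ℕ) (q-odd : suc k % 2 ≡ 1) where

  q = suc k
  s = shift q

  [jq+s]%2≡j%2 : ∀ j → (j * q + s) % 2 ≡ j % 2
  [jq+s]%2≡j%2 j = trans ([m+e]%2≡m%2 (j * q) s (shift%2≡0 q)) ([k*q]%2≡k%2 j q q-odd)

  n≤[2n+1]*q : ∀ n → n ≤ (2 * n + 1) * q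
  n≤[2n+1]*q n = ≤-trans (≤-trans (m≤m+n n (n + 0)) (m≤m+n _ 1)) (m≤m*n (2 * n + 1) q)

  plus-form⇒residue : ∀ m n → m ≡ (2 * n + 1) * q + s → (isOdd m ∧ nonRankResidue q m) ≡ true
  plus-form⇒residue m n m≡ = ∧-intro (≡⇒≡ᵇ-true m%2≡1) (∨-introˡ _ (≡⇒≡ᵇ-true m%q≡s%q))
    where
    m%2≡1 : m % 2 ≡ 1
    m%2≡1 = trans (cong (_% 2) m≡) (trans ([jq+s]%2≡j%2 (2 * n + 1)) ([2n+1]%2≡1 n))
    m%q≡s%q : m % q ≡ s % q
    m%q≡s%q = trans (cong (_% q) (trans m≡ (+-comm ((2 * n + 1) * q) s))) ([m+kn]%n≡m%n s (2 * n + 1) q)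

  minus-form⇒residue : ∀ m n → m + s ≡ (2 * n + 1) * q → (isOdd m ∧ nonRankResidue q m) ≡ true
  minus-form⇒residue m n m+s≡ = ∧-intro (≡⇒≡ᵇ-true m%2≡1) (∨-introʳ (m % q ≡ᵇ s % q) (≡⇒≡ᵇ-true [m+s]%q≡0))
    where
    open ≡-Reasoning
    m%2≡1 : m % 2 ≡ 1
    m%2≡1 = begin
      m % 2                   ≡⟨ [m+e]%2≡m%2 m s (shift%2≡0 q) ⟨
      (m + s) % 2             ≡⟨ cong (_% 2) m+s≡ ⟩
      ((2 * n + 1) * q) % 2   ≡⟨ [k*q]%2≡k%2 (2 * n + 1) q q-odd ⟩
      (2 * n + 1) % 2         ≡⟨ [2n+1]%2≡1 n ⟩
      1                       ∎
    [m+s]%q≡0 : (m + s) % q ≡ 0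
    [m+s]%q≡0 = trans (cong (_% q) m+s≡) (m*n%n≡0 (2 * n + 1) q)

  isNonRankB⇒residue : ∀ m → isNonRankB q m ≡ true → (isOdd m ∧ nonRankResidue q m) ≡ true
  isNonRankB⇒residue m e with ∨-elim {any (λ n → m ≡ᵇ (2 * n + 1) * q + s) (upTo (suc m))} e
  ... | inj₁ via-plus =
    let (n , _ , m≡ᵇ) = any-upTo-elim (λ n → m ≡ᵇ (2 * n + 1) * q + s) (suc m) via-plus
    in plus-form⇒residue m n (≡ᵇ-true⇒≡ {m} m≡ᵇ)
  ... | inj₂ via-minus =
    let (n , _ , both) = any-upTo-elim (λ n → (1 ≤ᵇ n) ∧ (m + s ≡ᵇ (2 * n + 1) * q)) (suc m + s) via-minus
    in minus-form⇒residue m n (≡ᵇ-true⇒≡ {m + s} (proj₂ (∧-elim {1 ≤ᵇ n} both)))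

  residue⇒isNonRankB : ∀ m → s ≤ m → q < m → (isOdd m ∧ nonRankResidue q m) ≡ true → isNonRankB q m ≡ true
  residue⇒isNonRankB m s≤m q<m e with ∧-elim {isOdd m} e
  ... | m-odd , residue with ∨-elim {m % q ≡ᵇ s % q} residue
  ... | inj₁ via-plus = ∨-introˡ _ (any-upTo-intro (λ n → m ≡ᵇ (2 * n + 1) * q + s) (suc m) n n<1+m (≡⇒≡ᵇ-true m≡))
    where
    j = m / q ∸ s / q
    m≡s+jq : m ≡ s + j * q
    m≡s+jq = begin
      m                          ≡⟨ m≡m%n+[m/n]*n m q ⟩
      m % q + m / q * q          ≡⟨ cong₂ _+_ (≡ᵇ-true⇒≡ {m % q} via-plus) (cong (_* q) (sym (m+[n∸m]≡n (/-monoˡ-≤ q s≤m)))) ⟩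
      s % q + (s / q + j) * q    ≡⟨ cong (_+_ (s % q)) (*-distribʳ-+ q (s / q) j) ⟩
      s % q + (s / q * q + j * q) ≡⟨ +-assoc (s % q) _ _ ⟨
      s % q + s / q * q + j * q  ≡⟨ cong (_+ j * q) (m≡m%n+[m/n]*n s q) ⟨
      s + j * q                  ∎
      where open ≡-Reasoning
    j-odd : j % 2 ≡ 1
    j-odd = trans (sym ([jq+s]%2≡j%2 j))
                  (trans (cong (_% 2) (trans (+-comm (j * q) s) (sym m≡s+jq))) (≡ᵇ-true⇒≡ {m % 2} m-odd))
    n = j / 2
    m≡ : m ≡ (2 * n + 1) * q + s
    m≡ = trans m≡s+jq (trans (+-comm s (j * q)) (cong (λ z → z * q + s) (odd⇒≡2*[k/2]+1 j j-odd)))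
    n<1+m : n < suc m
    n<1+m = s≤s (≤-trans (n≤[2n+1]*q n) (≤-trans (m≤m+n _ s) (≤-reflexive (sym m≡))))
  ... | inj₂ via-minus = ∨-introʳ (any (λ n → m ≡ᵇ (2 * n + 1) * q + s) (upTo (suc m)))
                  (any-upTo-intro (λ n → (1 ≤ᵇ n) ∧ (m + s ≡ᵇ (2 * n + 1) * q)) (suc m + s) n n<1+m+s (∧-intro (≤⇒≤ᵇ-true 1≤n) (≡⇒≡ᵇ-true m+s≡)))
    where
    q∣m+s : q ∣ m + s
    q∣m+s = m%n≡0⇒n∣m (m + s) q (≡ᵇ-true⇒≡ {(m + s) % q} via-minus)
    j = _∣_.quotient q∣m+s
    j-odd : j % 2 ≡ 1
    j-odd = trans (sym ([k*q]%2≡k%2 j q q-odd))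
                  (trans (cong (_% 2) (sym (_∣_.equality q∣m+s)))
                         (trans ([m+e]%2≡m%2 m s (shift%2≡0 q)) (≡ᵇ-true⇒≡ {m % 2} m-odd)))
    n = j / 2
    m+s≡ : m + s ≡ (2 * n + 1) * q
    m+s≡ = trans (_∣_.equality q∣m+s) (cong (_* q) (odd⇒≡2*[k/2]+1 j j-odd))
    -- n = 0 would give m + s = q < m.
    1≤n : 1 ≤ n
    1≤n with n | m+s≡
    ... | zero  | m+s≡q+0 = ⊥-elim (<⇒≱ q<m (≤-trans (m≤m+n m s) (≤-reflexive (trans m+s≡q+0 (+-identityʳ q)))))
    ... | suc _ | _       = s≤s z≤n
    n<1+m+s : n < suc m + s
    n<1+m+s = s≤s (≤-trans (n≤[2n+1]*q n) (≤-reflexive (sym m+s≡)))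

  isNonRankB-large : ∀ m → s ≤ m → q < m → isNonRankB q m ≡ (isOdd m ∧ nonRankResidue q m)
  isNonRankB-large m s≤m q<m = bool-ext (isNonRankB⇒residue m) (residue⇒isNonRankB m s≤m q<m)

isNonRankB-large : ∀ q m → isPrime5B q ≡ true → 4 * q < m → isNonRankB q m ≡ (isOdd m ∧ nonRankResidue q m)
isNonRankB-large q@(suc k) m q-prime 4q<m =
  NonRanks.isNonRankB-large k (prime≥5⇒odd q pq 5≤q) m (≤-trans (shift≤4q q) (<⇒≤ 4q<m))
    (≤-trans (s≤s (m≤m+n q _)) 4q<m)
  where
  pq : Prime q
  pq = proj₁ (isPrime5B-sound q q-prime)
  5≤q : 5 ≤ q
  5≤q = proj₂ (isPrime5B-sound q q-prime)

-- The sieve by the primes 5 ≤ q < n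

survives : ℕ → ℕ → Bool
survives n m = all (λ q → not (isPrime5B q ∧ nonRankResidue q m)) (upTo n)

-- ∏ p and ∏ (p − 2) over the primes 5 ≤ p < n; thus sieveModulus (suc p_j) is the paper's L(p_j).
sieveModulus : ℕ → ℕ
sieveModulus zero    = 1
sieveModulus (suc n) = if isPrime5B n then sieveModulus n * n else sieveModulus n

sieveSurvivors : ℕ → ℕ
sieveSurvivors zero    = 1
sieveSurvivors (suc n) = if isPrime5B n then sieveSurvivors n * (n ∸ 2) else sieveSurvivors n

sieveModulus-pos : ∀ n → 0 < sieveModulus n
sieveModulus-pos zero = z<s
sieveModulus-pos (suc n) with isPrime5B n in n-prime
... | true  = *-mono-≤ (sieveModulus-pos n) (≤-trans z<s (proj₂ (isPrime5B-sound n n-prime)))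
... | false = sieveModulus-pos n

sieveModulus-nonZero : ∀ n → NonZero (sieveModulus n)
sieveModulus-nonZero n = >-nonZero (sieveModulus-pos n)

sieveSurvivors-pos : ∀ n → 0 < sieveSurvivors n
sieveSurvivors-pos zero = z<s
sieveSurvivors-pos (suc n) with isPrime5B n in n-prime
... | true  = *-mono-≤ (sieveSurvivors-pos n) (≤-trans z<s (∸-monoˡ-≤ 2 (proj₂ (isPrime5B-sound n n-prime))))
... | false = sieveSurvivors-pos n

sieveSurvivors≤sieveModulus : ∀ n → sieveSurvivors n ≤ sieveModulus n
sieveSurvivors≤sieveModulus zero = ≤-refl
sieveSurvivors≤sieveModulus (suc n) with isPrime5B n
... | true  = *-mono-≤ (sieveSurvivors≤sieveModulus n) (m∸n≤m n 2)
... | false = sieveSurvivors≤sieveModulus n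

sieve-suc-prime : ∀ n → isPrime5B n ≡ true →
  sieveModulus (suc n) ≡ sieveModulus n * n × sieveSurvivors (suc n) ≡ sieveSurvivors n * (n ∸ 2)
sieve-suc-prime n e = cong (λ b → if b then sieveModulus n * n else sieveModulus n) e
                    , cong (λ b → if b then sieveSurvivors n * (n ∸ 2) else sieveSurvivors n) e

sieve-suc-composite : ∀ n → isPrime5B n ≡ false →
  sieveModulus (suc n) ≡ sieveModulus n × sieveSurvivors (suc n) ≡ sieveSurvivors n
sieve-suc-composite n e = cong (λ b → if b then sieveModulus n * n else sieveModulus n) e
                        , cong (λ b → if b then sieveSurvivors n * (n ∸ 2) else sieveSurvivors n) e

prime∤sieveModulus : ∀ {r} n → Prime r → (isPrime5B r ≡ true → n ≤ r) → ¬ r ∣ sieveModulus n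
prime∤sieveModulus zero pr _ r∣1 = prime≢1 pr (∣1⇒≡1 r∣1)
prime∤sieveModulus {r} (suc n) pr large with isPrime5B n in n-prime
... | false = prime∤sieveModulus n pr (λ r-prime → <⇒≤ (large r-prime))
... | true = λ r∣Mn → case (euclidsLemma (sieveModulus n) n pr r∣Mn)
  where
  case : r ∣ sieveModulus n ⊎ r ∣ n → ⊥
  case (inj₁ r∣M) = prime∤sieveModulus n pr (λ r-prime → <⇒≤ (large r-prime)) r∣M
  case (inj₂ r∣n) with prime∣prime⇒≡ pr (proj₁ (isPrime5B-sound n n-prime)) r∣n
  ... | refl = <-irrefl refl (large n-prime)

sieveModulus⊥prime : ∀ n → Prime n → Coprime (sieveModulus n) n
sieveModulus⊥prime n pn = Coprime-sym (prime∤⇒coprime pn (prime∤sieveModulus n pn (λ _ → ≤-refl)))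

2∤sieveModulus : ∀ n → ¬ 2 ∣ sieveModulus n
2∤sieveModulus n = prime∤sieveModulus n prime[2] (λ ())

survives-suc : ∀ n m → survives (suc n) m ≡ survives n m ∧ not (isPrime5B n ∧ nonRankResidue n m)
survives-suc n m = all-upTo-suc (λ q → not (isPrime5B q ∧ nonRankResidue q m)) n

-- Each new prime p multiplies the period by p and the survivors by p − 2, by the coprime count.
sieve : ∀ n → Periodic (survives n) (sieveModulus n) × countFrom (survives n) 0 (sieveModulus n) ≡ sieveSurvivors n
sieve zero = (λ m → refl) , refl
sieve (suc n) with isPrime5B n in n-prime
... | false = periodic-resp skip (proj₁ (sieve n))
            , trans (countFrom-resp (survives (suc n)) (survives n) 0 (sieveModulus n) skip) (proj₂ (sieve n))
  where
  skip : ∀ m → survives (suc n) m ≡ survives n m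
  skip m = trans (survives-suc n m) (trans (cong (λ b → survives n m ∧ not (b ∧ nonRankResidue n m)) n-prime)
                                           (Boolₚ.∧-identityʳ _))
... | true = periodic-resp step C.periodic-∧
           , trans (countFrom-resp (survives (suc n)) _ 0 (sieveModulus n * n) step)
                   (trans C.countFrom-∧ (cong₂ _*_ (proj₂ (sieve n)) avoided))
  where
  pn : Prime n
  pn = proj₁ (isPrime5B-sound n n-prime)
  step : ∀ m → survives (suc n) m ≡ survives n m ∧ not (nonRankResidue n m)
  step m = trans (survives-suc n m) (cong (λ b → survives n m ∧ not (b ∧ nonRankResidue n m)) n-prime)
  module C = CoprimePeriods (survives n) (λ m → not (nonRankResidue n m)) (sieveModulus n) n {{sieveModulus-nonZero n}}
               (proj₁ (sieve n)) (periodic-not (nonRankResidue n) (nonRankResidue-periodic n)) (sieveModulus⊥prime n pn)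
  avoided : countFrom (λ m → not (nonRankResidue n m)) 0 n ≡ n ∸ 2
  avoided = trans (countFrom-not (nonRankResidue n) 0 n)
                  (cong (n ∸_) (countFrom-nonRankResidue n pn (proj₂ (isPrime5B-sound n n-prime))))

parentResidue : ℕ → ℕ → Bool
parentResidue p m = isOdd m ∧ (nonRankResidue p m ∧ survives p m)

superResidue : ℕ → ℕ → Bool
superResidue n m = isOdd m ∧ not (survives n m)

parentResidue-periodic-count : ∀ p → Prime p → 5 ≤ p →
  Periodic (parentResidue p) (2 * (p * sieveModulus p)) ×
  countFrom (parentResidue p) 0 (2 * (p * sieveModulus p)) ≡ 2 * sieveSurvivors p
parentResidue-periodic-count p@(suc _) pp 5≤p =
  Odd.periodic-∧ , trans Odd.countFrom-∧ (trans (*-identityˡ _) sieved-count)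
  where
  p⊥M : Coprime p (sieveModulus p)
  p⊥M = prime∤⇒coprime pp (prime∤sieveModulus p pp (λ _ → ≤-refl))
  module Sieved = CoprimePeriods (nonRankResidue p) (survives p) p (sieveModulus p)
                    (nonRankResidue-periodic p) (proj₁ (sieve p)) p⊥M
  2∤pM : ¬ 2 ∣ p * sieveModulus p
  2∤pM 2∣pM with euclidsLemma p (sieveModulus p) prime[2] 2∣pM
  ... | inj₁ 2∣p = ≥5⇒≢2 5≤p (sym (prime∣prime⇒≡ prime[2] pp 2∣p))
  ... | inj₂ 2∣M = 2∤sieveModulus p 2∣M
  module Odd = CoprimePeriods isOdd (λ m → nonRankResidue p m ∧ survives p m) 2 (p * sieveModulus p)
                 isOdd-periodic Sieved.periodic-∧ (prime∤⇒coprime prime[2] 2∤pM)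
  sieved-count : countFrom (λ m → nonRankResidue p m ∧ survives p m) 0 (p * sieveModulus p) ≡ 2 * sieveSurvivors p
  sieved-count = trans Sieved.countFrom-∧ (cong₂ _*_ (countFrom-nonRankResidue p pp 5≤p) (proj₂ (sieve p)))

superResidue-periodic-count : ∀ n →
  Periodic (superResidue n) (2 * sieveModulus n) ×
  countFrom (superResidue n) 0 (2 * sieveModulus n) ≡ sieveModulus n ∸ sieveSurvivors n
superResidue-periodic-count n = Odd.periodic-∧ , trans Odd.countFrom-∧ (trans (*-identityˡ _) sieved-out)
  where
  module Odd = CoprimePeriods isOdd (λ m → not (survives n m)) 2 (sieveModulus n)
                 isOdd-periodic (periodic-not (survives n) (proj₁ (sieve n)))
                 (prime∤⇒coprime prime[2] (2∤sieveModulus n))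
  sieved-out : countFrom (λ m → not (survives n m)) 0 (sieveModulus n) ≡ sieveModulus n ∸ sieveSurvivors n
  sieved-out = trans (countFrom-not (survives n) 0 (sieveModulus n)) (cong (sieveModulus n ∸_) (proj₂ (sieve n)))

prime-isNonRankB-large : ∀ q m → 4 * q < m →
  isPrime5B q ∧ isNonRankB q m ≡ isPrime5B q ∧ (isOdd m ∧ nonRankResidue q m)
prime-isNonRankB-large q m 4q<m with isPrime5B q in q-prime
... | true  = isNonRankB-large q m q-prime 4q<m
... | false = refl

inAB-large : ∀ p → Prime p → 5 ≤ p → ∀ m → 4 * p < m → inAB p m ≡ parentResidue p m
inAB-large p pp 5≤p m 4p<m
  rewrite isPrime5B-complete p pp 5≤p
        | isNonRankB-large p m (isPrime5B-complete p pp 5≤p) 4p<m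
        | all-upTo-cong (λ q → not (isPrime5B q ∧ isNonRankB q m))
                        (λ q → not (isPrime5B q ∧ (isOdd m ∧ nonRankResidue q m))) p
                        (λ q q<p → cong not (prime-isNonRankB-large q m (≤-trans (s≤s (*-monoʳ-≤ 4 (<⇒≤ q<p))) 4p<m)))
  with isOdd m
... | true  = refl
... | false = refl

superResidue-suc : ∀ n m → superResidue (suc n) m ≡ superResidue n m ∨ (isPrime5B n ∧ parentResidue n m)
superResidue-suc n m = trans (cong (λ b → isOdd m ∧ not b) (survives-suc n m))
  (sieve-step (isOdd m) (survives n m) (isPrime5B n) (nonRankResidue n m))
  where
  sieve-step : ∀ o x b h → o ∧ not (x ∧ not (b ∧ h)) ≡ (o ∧ not x) ∨ (b ∧ (o ∧ (h ∧ x)))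
  sieve-step false x     b     h     = sym (cong₂ _∨_ refl (Boolₚ.∧-zeroʳ b))
  sieve-step true  false b     h     = refl
  sieve-step true  true  false h     = refl
  sieve-step true  true  true  false = refl
  sieve-step true  true  true  true  = refl

inSB-large : ∀ pj m → 4 * pj < m → inSB pj m ≡ superResidue (suc pj) m
inSB-large pj m 4pj<m = up-to (suc pj) ≤-refl
  where
  open ≡-Reasoning
  F : ℕ → Bool
  F p = isPrime5B p ∧ inAB p m
  prime-inAB : ∀ n → n ≤ pj → F n ≡ isPrime5B n ∧ parentResidue n m
  prime-inAB n n≤pj with bool-cases (isPrime5B n)
  ... | inj₁ n-prime = cong (isPrime5B n ∧_)
          (inAB-large n (proj₁ (isPrime5B-sound n n-prime)) (proj₂ (isPrime5B-sound n n-prime)) m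
                      (≤-trans (s≤s (*-monoʳ-≤ 4 n≤pj)) 4pj<m))
  ... | inj₂ n-composite = trans (cong (_∧ inAB n m) n-composite) (cong (_∧ parentResidue n m) (sym n-composite))
  up-to : ∀ n → n ≤ suc pj → any F (upTo n) ≡ superResidue n m
  up-to zero    _     = sym (Boolₚ.∧-zeroʳ (isOdd m))
  up-to (suc n) n<1+pj = begin
    any F (upTo (suc n))                                      ≡⟨ any-upTo-suc F n ⟩
    any F (upTo n) ∨ F n                                      ≡⟨ cong₂ _∨_ (up-to n (<⇒≤ n<1+pj)) (prime-inAB n (s≤s⁻¹ n<1+pj)) ⟩
    superResidue n m ∨ (isPrime5B n ∧ parentResidue n m)      ≡⟨ superResidue-suc n m ⟨
    superResidue (suc n) m                                    ∎

toℚᵘ-/ : ∀ a m′ → ℚ.toℚᵘ ((+ a) ℚ./ suc m′) ℚᵘ.≃ mkℚᵘ (+ a) m′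
toℚᵘ-/ a m′ = ℚₚ.toℚᵘ-fromℚᵘ (mkℚᵘ (+ a) m′)

/-cross-≡ : ∀ a b m n .{{_ : NonZero m}} .{{_ : NonZero n}} → a * n ≡ b * m → (+ a) ℚ./ m ≡ (+ b) ℚ./ n
/-cross-≡ a b (suc m′) (suc n′) an≡bm = ℚₚ.toℚᵘ-injective
  (ℚᵘₚ.≃-trans (toℚᵘ-/ a m′) (ℚᵘₚ.≃-trans (*≡* cross) (ℚᵘₚ.≃-sym (toℚᵘ-/ b n′))))
  where
  cross : + a ℤ.* +[1+ n′ ] ≡ + b ℤ.* +[1+ m′ ]
  cross = trans (sym (ℤₚ.pos-* a (suc n′))) (trans (cong +_ an≡bm) (ℤₚ.pos-* b (suc m′)))

/-cross-< : ∀ a b m n .{{_ : NonZero m}} .{{_ : NonZero n}} → a * n < b * m → (+ a) ℚ./ m ℚ.< (+ b) ℚ./ n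
/-cross-< a b (suc m′) (suc n′) an<bm = ℚₚ.toℚᵘ-cancel-<
  (ℚᵘₚ.<-respˡ-≃ (ℚᵘₚ.≃-sym (toℚᵘ-/ a m′)) (ℚᵘₚ.<-respʳ-≃ (ℚᵘₚ.≃-sym (toℚᵘ-/ b n′)) (*<* cross)))
  where
  cross : + a ℤ.* +[1+ n′ ] ℤ.< + b ℤ.* +[1+ m′ ]
  cross = subst₂ ℤ._<_ (ℤₚ.pos-* a (suc n′)) (ℤₚ.pos-* b (suc m′)) (+<+ an<bm)

/-cong : ∀ {a b m n} .{{_ : NonZero m}} .{{_ : NonZero n}} → a ≡ b → m ≡ n → (+ a) ℚ./ m ≡ (+ b) ℚ./ n
/-cong {a} {b} {m} {n} a≡b m≡n = /-cross-≡ a b m n (cong₂ _*_ a≡b (sym m≡n))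

/-*-/ : ∀ a b m n .{{_ : NonZero m}} .{{_ : NonZero n}} →
  ((+ a) ℚ./ m) ℚ.* ((+ b) ℚ./ n) ≡ ((+ (a * b)) ℚ./ (m * n)) {{m*n≢0 m n}}
/-*-/ a b (suc m′) (suc n′) = ℚₚ.toℚᵘ-injective (ℚᵘₚ.≃-trans (ℚₚ.toℚᵘ-homo-* ((+ a) ℚ./ suc m′) ((+ b) ℚ./ suc n′))
  (ℚᵘₚ.≃-trans (ℚᵘₚ.*-cong (toℚᵘ-/ a m′) (toℚᵘ-/ b n′))
  (ℚᵘₚ.≃-trans (*≡* (cong (ℤ._* (+[1+ m′ ] ℤ.* +[1+ n′ ])) (sym (ℤₚ.pos-* a b)))) (ℚᵘₚ.≃-sym (toℚᵘ-/ (a * b) (n′ + m′ * suc n′))))))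

/-+-/ : ∀ a b m n .{{_ : NonZero m}} .{{_ : NonZero n}} →
  (+ a) ℚ./ m ℚ.+ (+ b) ℚ./ n ≡ ((+ (a * n + b * m)) ℚ./ (m * n)) {{m*n≢0 m n}}
/-+-/ a b (suc m′) (suc n′) = ℚₚ.toℚᵘ-injective (ℚᵘₚ.≃-trans (ℚₚ.toℚᵘ-homo-+ ((+ a) ℚ./ suc m′) ((+ b) ℚ./ suc n′))
  (ℚᵘₚ.≃-trans (ℚᵘₚ.+-cong (toℚᵘ-/ a m′) (toℚᵘ-/ b n′))
  (ℚᵘₚ.≃-trans (*≡* (cong (ℤ._* (+[1+ m′ ] ℤ.* +[1+ n′ ])) numerator)) (ℚᵘₚ.≃-sym (toℚᵘ-/ (a * suc n′ + b * suc m′) (n′ + m′ * suc n′))))))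
  where
  numerator : + a ℤ.* +[1+ n′ ] ℤ.+ + b ℤ.* +[1+ m′ ] ≡ + (a * suc n′ + b * suc m′)
  numerator = sym (trans (ℤₚ.pos-+ (a * suc n′) (b * suc m′)) (cong₂ ℤ._+_ (ℤₚ.pos-* a (suc n′)) (ℤₚ.pos-* b (suc m′))))

/-∸-/ : ∀ a b m .{{_ : NonZero m}} → b ≤ a → (+ a) ℚ./ m ℚ.- (+ b) ℚ./ m ≡ (+ (a ∸ b)) ℚ./ m
/-∸-/ a b (suc m′) b≤a = ℚₚ.toℚᵘ-injective (ℚᵘₚ.≃-trans (ℚₚ.toℚᵘ-homo-+ ((+ a) ℚ./ suc m′) (ℚ.- ((+ b) ℚ./ suc m′)))
  (ℚᵘₚ.≃-trans (ℚᵘₚ.+-cong (toℚᵘ-/ a m′) (ℚᵘₚ.≃-trans (ℚₚ.toℚᵘ-homo‿- ((+ b) ℚ./ suc m′)) (ℚᵘₚ.-‿cong (toℚᵘ-/ b m′))))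
  (ℚᵘₚ.≃-trans (*≡* cross) (ℚᵘₚ.≃-sym (toℚᵘ-/ (a ∸ b) m′)))))
  where
  M = +[1+ m′ ]
  factor : ∀ A B M → (A ℤ.* M ℤ.+ (ℤ.- B) ℤ.* M) ℤ.* M ≡ (A ℤ.+ ℤ.- B) ℤ.* (M ℤ.* M)
  factor = ℤ-Solver.solve-∀
  cross : (+ a ℤ.* M ℤ.+ (ℤ.- (+ b)) ℤ.* M) ℤ.* M ≡ + (a ∸ b) ℤ.* (M ℤ.* M)
  cross = trans (factor (+ a) (+ b) M) (cong (ℤ._* (M ℤ.* M)) (trans (ℤₚ.m-n≡m⊖n a b) (ℤₚ.⊖-≥ b≤a)))

mkℚ≡/ : ∀ n d-1 .(n⊥d : Coprime n (suc d-1)) → mkℚ (+ n) d-1 n⊥d ≡ (+ n) ℚ./ suc d-1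
mkℚ≡/ n d-1 n⊥d = sym (ℚₚ.normalize-coprime n⊥d)

-- Densities of eventually periodic sets

count≡countFrom : ∀ f n → count f n ≡ countFrom f 1 n
count≡countFrom f zero    = refl
count≡countFrom f (suc n) = begin
  count f (suc n)                           ≡⟨ count-suc ⟩
  indicator (f (suc n)) + count f n         ≡⟨ +-comm (indicator (f (suc n))) _ ⟩
  count f n + indicator (f (suc n))         ≡⟨ cong₂ _+_ (count≡countFrom f n) (sym (+-identityʳ _)) ⟩
  countFrom f 1 n + (indicator (f (1 + n)) + 0)  ≡⟨ sumFrom-++ (λ x → indicator (f x)) 1 n 1 ⟨
  countFrom f 1 (n + 1)                     ≡⟨ cong (countFrom f 1) (+-comm n 1) ⟩
  countFrom f 1 (suc n)                     ∎
  where
  open ≡-Reasoning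
  count-suc : count f (suc n) ≡ indicator (f (suc n)) + count f n
  count-suc with f (suc n)
  ... | true  = refl
  ... | false = refl

countFrom-eventually-≤ : ∀ (f g : ℕ → Bool) m₀ → (∀ m → m₀ < m → f m ≡ g m) →
  ∀ a n → countFrom f a n ≤ countFrom g a n + (suc m₀ ∸ a)
countFrom-eventually-≤ f g m₀ f≈g a zero = z≤n
countFrom-eventually-≤ f g m₀ f≈g a (suc n) with a ≤? m₀
... | yes a≤m₀ = begin
  indicator (f a) + countFrom f (suc a) n                 ≤⟨ +-mono-≤ (indicator-≤1 (f a)) (countFrom-eventually-≤ f g m₀ f≈g (suc a) n) ⟩
  1 + (countFrom g (suc a) n + (m₀ ∸ a))                  ≡⟨ +-suc _ _ ⟨
  countFrom g (suc a) n + suc (m₀ ∸ a)                    ≤⟨ +-monoˡ-≤ _ (m≤n+m _ (indicator (g a))) ⟩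
  indicator (g a) + countFrom g (suc a) n + suc (m₀ ∸ a)  ≡⟨ cong (_+_ (indicator (g a) + countFrom g (suc a) n)) (+-∸-assoc 1 a≤m₀) ⟨
  indicator (g a) + countFrom g (suc a) n + (suc m₀ ∸ a)  ∎
  where open ≤-Reasoning
... | no a≰m₀ = begin
  indicator (f a) + countFrom f (suc a) n                 ≤⟨ +-mono-≤ (≤-reflexive (cong indicator (f≈g a m₀<a))) (countFrom-eventually-≤ f g m₀ f≈g (suc a) n) ⟩
  indicator (g a) + (countFrom g (suc a) n + (m₀ ∸ a))    ≡⟨ cong (λ z → indicator (g a) + (countFrom g (suc a) n + z)) (trans (m≤n⇒m∸n≡0 (<⇒≤ m₀<a)) (sym (m≤n⇒m∸n≡0 m₀<a))) ⟩
  indicator (g a) + (countFrom g (suc a) n + (suc m₀ ∸ a)) ≡⟨ +-assoc (indicator (g a)) _ _ ⟨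
  indicator (g a) + countFrom g (suc a) n + (suc m₀ ∸ a)  ∎
  where
  open ≤-Reasoning
  m₀<a = ≰⇒> a≰m₀

-- Writing n = qT + r, the count on [1, n] is qc + e with e ≤ r < T and c ≤ T, so |T·count − c·n| ≤ T².
periodic-count-bounds : ∀ g T .{{_ : NonZero T}} → Periodic g T → ∀ n →
  T * countFrom g 1 n ≤ countFrom g 0 T * n + T * T × countFrom g 0 T * n ≤ T * countFrom g 1 n + T * T
periodic-count-bounds g T g-per n = subst Bounds (sym n≡qT+r)
  (subst (λ x → T * x ≤ c * (q * T + r) + T * T × c * (q * T + r) ≤ T * x + T * T) (sym count≡qc+e) (above , below))
  where
  Bounds : ℕ → Set
  Bounds z = T * countFrom g 1 z ≤ countFrom g 0 T * z + T * T × countFrom g 0 T * z ≤ T * countFrom g 1 z + T * T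
  c = countFrom g 0 T
  q = n / T
  r = n % T
  e = countFrom g (1 + q * T) r
  n≡qT+r : n ≡ q * T + r
  n≡qT+r = trans (m≡m%n+[m/n]*n n T) (+-comm r (q * T))
  count≡qc+e : countFrom g 1 (q * T + r) ≡ q * c + e
  count≡qc+e = trans (sumFrom-++ (λ x → indicator (g x)) 1 (q * T) r) (cong (_+ e) (countFrom-periods g g-per 1 q))
  e≤T : e ≤ T
  e≤T = ≤-trans (countFrom-≤ g _ r) (<⇒≤ (m%n<n n T))
  open ≤-Reasoning
  above : T * (q * c + e) ≤ c * (q * T + r) + T * T
  above = begin
    T * (q * c + e)            ≡⟨ regroup T c q e ⟩
    c * (q * T) + T * e        ≤⟨ +-monoʳ-≤ (c * (q * T)) (*-monoʳ-≤ T e≤T) ⟩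
    c * (q * T) + T * T        ≤⟨ +-monoˡ-≤ (T * T) (*-monoʳ-≤ c (m≤m+n (q * T) r)) ⟩
    c * (q * T + r) + T * T    ∎
    where
    regroup : ∀ T c q e → T * (q * c + e) ≡ c * (q * T) + T * e
    regroup = solve-∀
  below : c * (q * T + r) ≤ T * (q * c + e) + T * T
  below = begin
    c * (q * T + r)            ≡⟨ regroup T c q r ⟩
    T * (q * c) + c * r        ≤⟨ +-mono-≤ (*-monoʳ-≤ T (m≤m+n (q * c) e)) (*-mono-≤ (countFrom-≤ g 0 T) (<⇒≤ (m%n<n n T))) ⟩
    T * (q * c + e) + T * T    ∎
    where
    regroup : ∀ T c q r → c * (q * T + r) ≡ T * (q * c) + c * r
    regroup = solve-∀

eventually-periodic-count-bounds : ∀ (f g : ℕ → Bool) m₀ T .{{_ : NonZero T}} → Periodic g T →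
  (∀ m → m₀ < m → f m ≡ g m) → ∀ n →
  T * count f n ≤ countFrom g 0 T * n + (T * T + T * m₀) × countFrom g 0 T * n ≤ T * count f n + (T * T + T * m₀)
eventually-periodic-count-bounds f g m₀ T g-per f≈g n rewrite count≡countFrom f n = above , below
  where
  c = countFrom g 0 T
  x = countFrom f 1 n
  y = countFrom g 1 n
  x≤y+m₀ : x ≤ y + m₀
  x≤y+m₀ = countFrom-eventually-≤ f g m₀ f≈g 1 n
  y≤x+m₀ : y ≤ x + m₀
  y≤x+m₀ = countFrom-eventually-≤ g f m₀ (λ m m₀<m → sym (f≈g m m₀<m)) 1 n
  periodic : T * y ≤ c * n + T * T × c * n ≤ T * y + T * T
  periodic = periodic-count-bounds g T g-per n
  open ≤-Reasoning
  above : T * x ≤ c * n + (T * T + T * m₀)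
  above = begin
    T * x                       ≤⟨ *-monoʳ-≤ T x≤y+m₀ ⟩
    T * (y + m₀)                ≡⟨ *-distribˡ-+ T y m₀ ⟩
    T * y + T * m₀              ≤⟨ +-monoˡ-≤ (T * m₀) (proj₁ periodic) ⟩
    c * n + T * T + T * m₀      ≡⟨ +-assoc (c * n) (T * T) (T * m₀) ⟩
    c * n + (T * T + T * m₀)    ∎
  below : c * n ≤ T * x + (T * T + T * m₀)
  below = begin
    c * n                       ≤⟨ proj₂ periodic ⟩
    T * y + T * T               ≤⟨ +-monoˡ-≤ (T * T) (*-monoʳ-≤ T y≤x+m₀) ⟩
    T * (x + m₀) + T * T        ≡⟨ regroup T x m₀ ⟩
    T * x + (T * T + T * m₀)    ∎
    where
    regroup : ∀ T x m₀ → T * (x + m₀) + T * T ≡ T * x + (T * T + T * m₀)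
    regroup = solve-∀

-- Once K b < n, the error K in |T x − c n| ≤ K is absorbed by ε = a/b (with a ≥ 1).
module ApproximateFraction (c T x n K a b : ℕ) .{{_ : NonZero T}} .{{_ : NonZero n}} .{{_ : NonZero b}}
                           (1≤a : 1 ≤ a) (Kb<n : K * b < n) where

  instance
    T*b≢0 : NonZero (T * b)
    T*b≢0 = m*n≢0 T b
    n*b≢0 : NonZero (n * b)
    n*b≢0 = m*n≢0 n b

  n≤a*T*n : n ≤ a * T * n
  n≤a*T*n = ≤-trans (≤-reflexive (sym (*-identityˡ n))) (*-monoˡ-≤ n (*-mono-≤ 1≤a (>-nonZero⁻¹ T)))

  below-sum : T * x ≤ c * n + K → (+ x) ℚ./ n ℚ.< (+ c) ℚ./ T ℚ.+ (+ a) ℚ./ b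
  below-sum Tx≤cn+K = subst (ℚ._<_ ((+ x) ℚ./ n)) (sym (/-+-/ c a T b)) (/-cross-< x (c * b + a * T) n (T * b) cross)
    where
    open ≤-Reasoning
    cross : x * (T * b) < (c * b + a * T) * n
    cross = begin-strict
      x * (T * b)                 ≡⟨ solve (x ∷ T ∷ b ∷ []) ⟩
      T * x * b                   ≤⟨ *-monoˡ-≤ b Tx≤cn+K ⟩
      (c * n + K) * b             ≡⟨ *-distribʳ-+ b (c * n) K ⟩
      c * n * b + K * b           <⟨ +-monoʳ-< (c * n * b) Kb<n ⟩
      c * n * b + n               ≤⟨ +-monoʳ-≤ (c * n * b) n≤a*T*n ⟩
      c * n * b + a * T * n       ≡⟨ solve (c ∷ n ∷ b ∷ a ∷ T ∷ []) ⟩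
      (c * b + a * T) * n         ∎

  above-difference : c * n ≤ T * x + K → (+ c) ℚ./ T ℚ.- (+ a) ℚ./ b ℚ.< (+ x) ℚ./ n
  above-difference cn≤Tx+K = subst (ℚ._<_ ((+ c) ℚ./ T ℚ.- (+ a) ℚ./ b)) ([q+r]-r≡q ((+ x) ℚ./ n) ((+ a) ℚ./ b))
    (ℚₚ.+-mono-<-≤ below-sum′ (ℚₚ.≤-refl {ℚ.- ((+ a) ℚ./ b)}))
    where
    open ≤-Reasoning
    cross : c * (n * b) < (x * b + a * n) * T
    cross = begin-strict
      c * (n * b)                 ≡⟨ solve (c ∷ n ∷ b ∷ []) ⟩
      c * n * b                   ≤⟨ *-monoˡ-≤ b cn≤Tx+K ⟩
      (T * x + K) * b             ≡⟨ *-distribʳ-+ b (T * x) K ⟩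
      T * x * b + K * b           <⟨ +-monoʳ-< (T * x * b) Kb<n ⟩
      T * x * b + n               ≤⟨ +-monoʳ-≤ (T * x * b) n≤a*T*n ⟩
      T * x * b + a * T * n       ≡⟨ solve (T ∷ x ∷ b ∷ a ∷ n ∷ []) ⟩
      (x * b + a * n) * T         ∎
    below-sum′ : (+ c) ℚ./ T ℚ.< (+ x) ℚ./ n ℚ.+ (+ a) ℚ./ b
    below-sum′ = subst (ℚ._<_ ((+ c) ℚ./ T)) (sym (/-+-/ x a n b)) (/-cross-< c (x * b + a * n) T (n * b) cross)
    [q+r]-r≡q : ∀ q r → q ℚ.+ r ℚ.- r ≡ q
    [q+r]-r≡q = +-*-Solver.solve 2 (λ q r → q :+ r :- r := q) refl
      where open +-*-Solver hiding (solve)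

eventually-periodic⇒density : ∀ (f g : ℕ → Bool) m₀ T .{{_ : NonZero T}} → Periodic g T →
  (∀ m → m₀ < m → f m ≡ g m) → HasDensity f ((+ countFrom g 0 T) ℚ./ T)
eventually-periodic⇒density f g m₀ T g-per f≈g (mkℚ (+ 0)      _ _) (ℚ.*<* (+<+ ()))
eventually-periodic⇒density f g m₀ T g-per f≈g (mkℚ -[1+ _ ]   _ _) (ℚ.*<* ())
eventually-periodic⇒density f g m₀ T g-per f≈g (mkℚ +[1+ a-1 ] b-1 a⊥b) _ = K * suc b-1 , within-ε
  where
  K = T * T + T * m₀
  d = (+ countFrom g 0 T) ℚ./ T
  within-ε : ∀ N → K * suc b-1 ≤ N →
    d ℚ.- mkℚ +[1+ a-1 ] b-1 a⊥b ℚ.< (+ count f (suc N)) ℚ./ suc N ×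
    (+ count f (suc N)) ℚ./ suc N ℚ.< d ℚ.+ mkℚ +[1+ a-1 ] b-1 a⊥b
  within-ε N K*b≤N = subst (λ ε → d ℚ.- ε ℚ.< x/n × x/n ℚ.< d ℚ.+ ε) (sym (mkℚ≡/ (suc a-1) b-1 a⊥b))
    (A.above-difference (proj₂ bounds) , A.below-sum (proj₁ bounds))
    where
    x/n = (+ count f (suc N)) ℚ./ suc N
    bounds : T * count f (suc N) ≤ countFrom g 0 T * suc N + K × countFrom g 0 T * suc N ≤ T * count f (suc N) + K
    bounds = eventually-periodic-count-bounds f g m₀ T g-per f≈g (suc N)
    module A = ApproximateFraction (countFrom g 0 T) T (count f (suc N)) (suc N) K (suc a-1) (suc b-1) (s≤s z≤n) (s≤s K*b≤N)

-- The products ∏ (p − 2)/p and the sums ∑ q(p)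

module _ (n : ℕ) where

  prodUpTo-suc-prime : isPrime5B (suc n) ≡ true → prodUpTo (suc n) ≡ prodUpTo n ℚ.* ((+ (suc n ∸ 2)) ℚ./ suc n)
  prodUpTo-suc-prime e with isPrime5B (suc n)
  prodUpTo-suc-prime refl | true = refl

  prodUpTo-suc-composite : isPrime5B (suc n) ≡ false → prodUpTo (suc n) ≡ prodUpTo n
  prodUpTo-suc-composite e with isPrime5B (suc n)
  prodUpTo-suc-composite refl | false = refl

  Qsum-suc-prime : isPrime5B (suc n) ≡ true → Qsum (suc n) ≡ Qsum n ℚ.+ qq (suc n)
  Qsum-suc-prime e with isPrime5B (suc n)
  Qsum-suc-prime refl | true = refl

  Qsum-suc-composite : isPrime5B (suc n) ≡ false → Qsum (suc n) ≡ Qsum n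
  Qsum-suc-composite e with isPrime5B (suc n)
  Qsum-suc-composite refl | false = refl

prodUpTo≡survivors/modulus : ∀ n → prodUpTo n ≡ ((+ sieveSurvivors (suc n)) ℚ./ sieveModulus (suc n)) {{sieveModulus-nonZero (suc n)}}
prodUpTo≡survivors/modulus zero    = refl
prodUpTo≡survivors/modulus (suc n) with bool-cases (isPrime5B (suc n))
... | inj₁ prime = trans (prodUpTo-suc-prime n prime)
  (trans (cong (ℚ._* ((+ (suc n ∸ 2)) ℚ./ suc n)) (prodUpTo≡survivors/modulus n))
  (trans (/-*-/ S (suc n ∸ 2) M (suc n))
         (/-cong (sym (proj₂ step)) (sym (proj₁ step)))))
  where
  S = sieveSurvivors (suc n)
  M = sieveModulus (suc n)
  instance _ = sieveModulus-nonZero (suc n)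
  instance _ = sieveModulus-nonZero (suc (suc n))
  instance _ = m*n≢0 M (suc n)
  step : sieveModulus (suc (suc n)) ≡ M * suc n × sieveSurvivors (suc (suc n)) ≡ S * (suc n ∸ 2)
  step = sieve-suc-prime (suc n) prime
... | inj₂ composite = trans (prodUpTo-suc-composite n composite)
  (trans (prodUpTo≡survivors/modulus n)
         (/-cong {{sieveModulus-nonZero (suc n)}} {{sieveModulus-nonZero (suc (suc n))}} (sym (proj₂ step)) (sym (proj₁ step))))
  where
  step : sieveModulus (suc (suc n)) ≡ sieveModulus (suc n) × sieveSurvivors (suc (suc n)) ≡ sieveSurvivors (suc n)
  step = sieve-suc-composite (suc n) composite

qq≡survivors/[p*modulus] : ∀ p .{{p≢0 : NonZero p}} →
  qq p ≡ ((+ sieveSurvivors p) ℚ./ (p * sieveModulus p)) {{m*n≢0 p (sieveModulus p) {{p≢0}} {{sieveModulus-nonZero p}}}}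
qq≡survivors/[p*modulus] p@(suc k) = begin
  ((+ 1) ℚ./ p) ℚ.* prodUpTo k                 ≡⟨ cong (ℚ._*_ ((+ 1) ℚ./ p)) (prodUpTo≡survivors/modulus k) ⟩
  ((+ 1) ℚ./ p) ℚ.* ((+ S) ℚ./ M)               ≡⟨ /-*-/ 1 S p M ⟩
  (+ (1 * S)) ℚ./ (p * M)                       ≡⟨ /-cong (*-identityˡ S) refl ⟩
  (+ S) ℚ./ (p * M)                             ∎
  where
  open ≡-Reasoning
  S = sieveSurvivors p
  M = sieveModulus p
  instance _ = sieveModulus-nonZero p
  instance _ = m*n≢0 p M

[m∸2]/m≡1-[1/m+1/m] : ∀ m .{{_ : NonZero m}} → 2 ≤ m → (+ (m ∸ 2)) ℚ./ m ≡ 1ℚ ℚ.- ((+ 1) ℚ./ m ℚ.+ (+ 1) ℚ./ m)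
[m∸2]/m≡1-[1/m+1/m] m 2≤m = begin
  (+ (m ∸ 2)) ℚ./ m                                  ≡⟨ /-∸-/ m 2 m 2≤m ⟨
  (+ m) ℚ./ m ℚ.- (+ 2) ℚ./ m                        ≡⟨ cong₂ ℚ._-_ (/-cross-≡ m 1 m 1 (*-comm m 1)) two ⟩
  1ℚ ℚ.- ((+ 1) ℚ./ m ℚ.+ (+ 1) ℚ./ m)               ∎
  where
  open ≡-Reasoning
  instance _ = m*n≢0 m m
  two : (+ 2) ℚ./ m ≡ (+ 1) ℚ./ m ℚ.+ (+ 1) ℚ./ m
  two = sym (trans (/-+-/ 1 1 m m) (/-cross-≡ (1 * m + 1 * m) 2 (m * m) m (solve (m ∷ []))))

Qsum≡½[1-prodUpTo] : ∀ n → Qsum n ≡ ½ ℚ.* (1ℚ ℚ.- prodUpTo n)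
Qsum≡½[1-prodUpTo] zero = refl
Qsum≡½[1-prodUpTo] (suc n) with bool-cases (isPrime5B (suc n))
... | inj₂ composite = begin
  Qsum (suc n)                          ≡⟨ Qsum-suc-composite n composite ⟩
  Qsum n                                ≡⟨ Qsum≡½[1-prodUpTo] n ⟩
  ½ ℚ.* (1ℚ ℚ.- prodUpTo n)             ≡⟨ cong (λ y → ½ ℚ.* (1ℚ ℚ.- y)) (prodUpTo-suc-composite n composite) ⟨
  ½ ℚ.* (1ℚ ℚ.- prodUpTo (suc n))       ∎
  where open ≡-Reasoning
... | inj₁ prime = begin
  Qsum (suc n)                                         ≡⟨ Qsum-suc-prime n prime ⟩
  Qsum n ℚ.+ i ℚ.* Y                                   ≡⟨ cong (ℚ._+ i ℚ.* Y) (Qsum≡½[1-prodUpTo] n) ⟩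
  ½ ℚ.* (1ℚ ℚ.- Y) ℚ.+ i ℚ.* Y                         ≡⟨ cong (ℚ._+_ (½ ℚ.* (1ℚ ℚ.- Y))) (ℚₚ.*-identityˡ (i ℚ.* Y)) ⟨
  ½ ℚ.* (1ℚ ℚ.- Y) ℚ.+ (½ ℚ.+ ½) ℚ.* (i ℚ.* Y)         ≡⟨ distribute ½ i Y ⟨
  ½ ℚ.* (1ℚ ℚ.- Y ℚ.* (1ℚ ℚ.- (i ℚ.+ i)))              ≡⟨ cong (λ z → ½ ℚ.* (1ℚ ℚ.- Y ℚ.* z)) ([m∸2]/m≡1-[1/m+1/m] (suc n) 2≤1+n) ⟨
  ½ ℚ.* (1ℚ ℚ.- Y ℚ.* ((+ (suc n ∸ 2)) ℚ./ suc n))     ≡⟨ cong (λ y → ½ ℚ.* (1ℚ ℚ.- y)) (prodUpTo-suc-prime n prime) ⟨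
  ½ ℚ.* (1ℚ ℚ.- prodUpTo (suc n))                      ∎
  where
  open ≡-Reasoning
  i = (+ 1) ℚ./ suc n
  Y = prodUpTo n
  2≤1+n : 2 ≤ suc n
  2≤1+n = ≤-trans (s≤s (s≤s z≤n)) (proj₂ (isPrime5B-sound (suc n) prime))
  distribute : ∀ h i Y → h ℚ.* (1ℚ ℚ.- Y ℚ.* (1ℚ ℚ.- (i ℚ.+ i))) ≡ h ℚ.* (1ℚ ℚ.- Y) ℚ.+ (h ℚ.+ h) ℚ.* (i ℚ.* Y)
  distribute = +-*-Solver.solve 3 (λ h i Y → h :* (con 1ℚ :- Y :* (con 1ℚ :- (i :+ i))) := h :* (con 1ℚ :- Y) :+ (h :+ h) :* (i :* Y)) refl
    where open +-*-Solver hiding (solve)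

Qsum≡[modulus∸survivors]/[2*modulus] : ∀ n → Qsum n ≡
  ((+ (sieveModulus (suc n) ∸ sieveSurvivors (suc n))) ℚ./ (2 * sieveModulus (suc n))) {{m*n≢0 2 _ {{_}} {{sieveModulus-nonZero (suc n)}}}}
Qsum≡[modulus∸survivors]/[2*modulus] n = begin
  Qsum n                                      ≡⟨ Qsum≡½[1-prodUpTo] n ⟩
  ½ ℚ.* (1ℚ ℚ.- prodUpTo n)                   ≡⟨ cong (λ y → ½ ℚ.* (1ℚ ℚ.- y)) (prodUpTo≡survivors/modulus n) ⟩
  ½ ℚ.* (1ℚ ℚ.- (+ S) ℚ./ M)                  ≡⟨ cong (λ o → ½ ℚ.* (o ℚ.- (+ S) ℚ./ M)) (/-cross-≡ 1 M 1 M (*-comm 1 M)) ⟩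
  ½ ℚ.* ((+ M) ℚ./ M ℚ.- (+ S) ℚ./ M)         ≡⟨ cong (ℚ._*_ ½) (/-∸-/ M S M (sieveSurvivors≤sieveModulus (suc n))) ⟩
  ½ ℚ.* ((+ (M ∸ S)) ℚ./ M)                   ≡⟨ /-*-/ 1 (M ∸ S) 2 M ⟩
  (+ (1 * (M ∸ S))) ℚ./ (2 * M)               ≡⟨ /-cong (*-identityˡ (M ∸ S)) refl ⟩
  (+ (M ∸ S)) ℚ./ (2 * M)                     ∎
  where
  open ≡-Reasoning
  M = sieveModulus (suc n)
  S = sieveSurvivors (suc n)
  instance _ = sieveModulus-nonZero (suc n)
  instance _ = m*n≢0 2 M

survivorRatio-antitone : ∀ m t → sieveSurvivors (m + t) * sieveModulus m ≤ sieveSurvivors m * sieveModulus (m + t)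
survivorRatio-antitone m zero rewrite +-identityʳ m = ≤-refl
survivorRatio-antitone m (suc t) rewrite +-suc m t with bool-cases (isPrime5B (m + t))
... | inj₂ composite rewrite proj₁ (sieve-suc-composite (m + t) composite)
                           | proj₂ (sieve-suc-composite (m + t) composite) = survivorRatio-antitone m t
... | inj₁ prime rewrite proj₁ (sieve-suc-prime (m + t) prime)
                       | proj₂ (sieve-suc-prime (m + t) prime) = begin
  sieveSurvivors n * (n ∸ 2) * sieveModulus m    ≡⟨ m*n*o≡m*o*n (sieveSurvivors n) (n ∸ 2) (sieveModulus m) ⟩
  sieveSurvivors n * sieveModulus m * (n ∸ 2)    ≤⟨ *-mono-≤ (survivorRatio-antitone m t) (m∸n≤m n 2) ⟩
  sieveSurvivors m * sieveModulus n * n          ≡⟨ *-assoc (sieveSurvivors m) (sieveModulus n) n ⟩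
  sieveSurvivors m * (sieveModulus n * n)        ∎
  where
  open ≤-Reasoning
  n = m + t

qq-decreasing : ∀ p p′ .{{_ : NonZero p}} .{{_ : NonZero p′}} → p < p′ → qq p′ ℚ.< qq p
qq-decreasing p p′ p<p′ = subst₂ ℚ._<_ (sym (qq≡survivors/[p*modulus] p′)) (sym (qq≡survivors/[p*modulus] p))
  (/-cross-< S′ S (p′ * M′) (p * M) cross)
  where
  open ≤-Reasoning
  S = sieveSurvivors p
  M = sieveModulus p
  S′ = sieveSurvivors p′
  M′ = sieveModulus p′
  instance _ = sieveModulus-nonZero p
  instance _ = sieveModulus-nonZero p′
  instance _ = m*n≢0 p M
  instance _ = m*n≢0 p′ M′
  antitone : S′ * M ≤ S * M′
  antitone = subst (λ z → sieveSurvivors z * M ≤ S * sieveModulus z) (m+[n∸m]≡n (<⇒≤ p<p′))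
                   (survivorRatio-antitone p (p′ ∸ p))
  instance _ = >-nonZero (*-mono-≤ (sieveSurvivors-pos p) (sieveModulus-pos p′))
  cross : S′ * (p * M) < S * (p′ * M′)
  cross = begin-strict
    S′ * (p * M)       ≡⟨ m*[n*o]≡n*[m*o] S′ p M ⟩
    p * (S′ * M)       ≤⟨ *-monoʳ-≤ p antitone ⟩
    p * (S * M′)       <⟨ *-monoˡ-< (S * M′) p<p′ ⟩
    p′ * (S * M′)      ≡⟨ m*[n*o]≡n*[m*o] p′ S M′ ⟩
    S * (p′ * M′)      ∎

Qsum-increasing : ∀ p p′ → Prime p′ → 5 ≤ p′ → p < p′ → Qsum p ℚ.< Qsum p′
Qsum-increasing p p′ pp′ 5≤p′ p<p′ =
  subst₂ ℚ._<_ (sym (Qsum≡[modulus∸survivors]/[2*modulus] p)) (sym (Qsum≡[modulus∸survivors]/[2*modulus] p′))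
    (/-cross-< (M₁ ∸ S₁) (M₂ ∸ S₂) (2 * M₁) (2 * M₂) (subst₂ _<_ (m*[n*o]≡n*[m*o] 2 (M₁ ∸ S₁) M₂) (m*[n*o]≡n*[m*o] 2 (M₂ ∸ S₂) M₁) (*-monoʳ-< 2 mid)))
  where
  open ≤-Reasoning
  M₁ = sieveModulus (suc p)
  S₁ = sieveSurvivors (suc p)
  M₂ = sieveModulus (suc p′)
  S₂ = sieveSurvivors (suc p′)
  instance _ = sieveModulus-nonZero (suc p)
  instance _ = sieveModulus-nonZero (suc p′)
  instance _ = m*n≢0 2 M₁
  instance _ = m*n≢0 2 M₂
  step : M₂ ≡ sieveModulus p′ * p′ × S₂ ≡ sieveSurvivors p′ * (p′ ∸ 2)
  step = sieve-suc-prime p′ (isPrime5B-complete p′ pp′ 5≤p′)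
  antitone : sieveSurvivors p′ * M₁ ≤ S₁ * sieveModulus p′
  antitone = subst (λ z → sieveSurvivors z * M₁ ≤ S₁ * sieveModulus z) (m+[n∸m]≡n p<p′)
                   (survivorRatio-antitone (suc p) (p′ ∸ suc p))
  instance _ = >-nonZero (*-mono-≤ (sieveSurvivors-pos (suc p)) (sieveModulus-pos p′))
  -- the prime p′ removes a positive proportion 2/p′ of the survivors
  core : S₂ * M₁ < S₁ * M₂
  core = begin-strict
    S₂ * M₁                                        ≡⟨ cong (_* M₁) (proj₂ step) ⟩
    sieveSurvivors p′ * (p′ ∸ 2) * M₁              ≡⟨ m*n*o≡m*o*n (sieveSurvivors p′) (p′ ∸ 2) M₁ ⟩
    sieveSurvivors p′ * M₁ * (p′ ∸ 2)              ≤⟨ *-monoˡ-≤ (p′ ∸ 2) antitone ⟩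
    S₁ * sieveModulus p′ * (p′ ∸ 2)                <⟨ *-monoʳ-< (S₁ * sieveModulus p′) (∸-monoʳ-< {p′} {2} {0} z<s (≤-trans (s≤s (s≤s z≤n)) 5≤p′)) ⟩
    S₁ * sieveModulus p′ * p′                      ≡⟨ *-assoc S₁ (sieveModulus p′) p′ ⟩
    S₁ * (sieveModulus p′ * p′)                    ≡⟨ cong (_*_ S₁) (proj₁ step) ⟨
    S₁ * M₂                                        ∎
  mid : (M₁ ∸ S₁) * M₂ < (M₂ ∸ S₂) * M₁
  mid = begin-strict
    (M₁ ∸ S₁) * M₂        ≡⟨ *-distribʳ-∸ M₂ M₁ S₁ ⟩
    M₁ * M₂ ∸ S₁ * M₂     <⟨ ∸-monoʳ-< core (*-monoˡ-≤ M₂ (sieveSurvivors≤sieveModulus (suc p))) ⟩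
    M₁ * M₂ ∸ S₂ * M₁     ≡⟨ cong (_∸ S₂ * M₁) (*-comm M₁ M₂) ⟩
    M₂ * M₁ ∸ S₂ * M₁     ≡⟨ *-distribʳ-∸ M₁ M₂ S₂ ⟨
    (M₂ ∸ S₂) * M₁        ∎

inAB-density : ∀ p .{{_ : NonZero p}} → Prime p → 5 ≤ p → HasDensity (inAB p) (qq p)
inAB-density p pp 5≤p = subst (HasDensity (inAB p)) density≡qq
  (eventually-periodic⇒density (inAB p) (parentResidue p) (4 * p) T (proj₁ periodic-count) (inAB-large p pp 5≤p))
  where
  open ≡-Reasoning
  S = sieveSurvivors p
  M = sieveModulus p
  T = 2 * (p * M)
  instance _ = sieveModulus-nonZero p
  instance _ = m*n≢0 p M
  instance _ = m*n≢0 2 (p * M)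
  periodic-count : Periodic (parentResidue p) T × countFrom (parentResidue p) 0 T ≡ 2 * S
  periodic-count = parentResidue-periodic-count p pp 5≤p
  density≡qq : (+ countFrom (parentResidue p) 0 T) ℚ./ T ≡ qq p
  density≡qq = begin
    (+ countFrom (parentResidue p) 0 T) ℚ./ T    ≡⟨ /-cong (proj₂ periodic-count) refl ⟩
    (+ (2 * S)) ℚ./ (2 * (p * M))                ≡⟨ /-cross-≡ (2 * S) S T (p * M) (trans (*-assoc 2 S (p * M)) (m*[n*o]≡n*[m*o] 2 S (p * M))) ⟩
    (+ S) ℚ./ (p * M)                            ≡⟨ qq≡survivors/[p*modulus] p ⟨
    qq p                                         ∎

inSB-density : ∀ pj → HasDensity (inSB pj) (Qsum pj)
inSB-density pj = subst (HasDensity (inSB pj)) density≡Qsum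
  (eventually-periodic⇒density (inSB pj) (superResidue (suc pj)) (4 * pj) T (proj₁ periodic-count) (inSB-large pj))
  where
  M = sieveModulus (suc pj)
  T = 2 * M
  instance _ = sieveModulus-nonZero (suc pj)
  instance _ = m*n≢0 2 M
  periodic-count : Periodic (superResidue (suc pj)) T × countFrom (superResidue (suc pj)) 0 T ≡ M ∸ sieveSurvivors (suc pj)
  periodic-count = superResidue-periodic-count (suc pj)
  density≡Qsum : (+ countFrom (superResidue (suc pj)) 0 T) ℚ./ T ≡ Qsum pj
  density≡Qsum = trans (/-cong (proj₂ periodic-count) refl) (sym (Qsum≡[modulus∸survivors]/[2*modulus] pj))

proposition4p5 : ∀ (pj : ℕ) → Prime pj → 5 ≤ pj →
      -- (i) density of 𝒜_{p_i} is q(p_i), for every prime 5 ≤ p_i ≤ p_j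
      (∀ (p : ℕ) .{{_ : NonZero p}} → Prime p → 5 ≤ p → p ≤ pj → HasDensity (inAB p) (qq p))
      -- (i) q is strictly decreasing on primes ≥ 5
    × (∀ (p p′ : ℕ) .{{_ : NonZero p}} .{{_ : NonZero p′}} → Prime p → Prime p′ → 5 ≤ p → p < p′ →
          qq p′ ℚ.< qq p)
      -- (ii) density of 𝒮_{p_j} is Q(p_j) = ∑ q(p) = ½ (1 − ∏ (p−2)/p)
    × HasDensity (inSB pj) (Qsum pj)
    × Qsum pj ≡ ½ ℚ.* (1ℚ ℚ.- prodUpTo pj)
      -- (iii) Q is strictly increasing on primes ≥ 5
    × (∀ (p p′ : ℕ) → Prime p → Prime p′ → 5 ≤ p → p < p′ → Qsum p ℚ.< Qsum p′)
proposition4p5 pj _ _ =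
    (λ p pp 5≤p _ → inAB-density p pp 5≤p)
  , (λ p p′ _ _ _ p<p′ → qq-decreasing p p′ p<p′)
  , inSB-density pj
  , Qsum≡½[1-prodUpTo] pj
  , (λ p p′ _ pp′ 5≤p p<p′ → Qsum-increasing p p′ pp′ (≤-trans 5≤p (<⇒≤ p<p′)) p<p′)
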